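{- For $m\ge1$, $n\ge0$, $k\ge0$, $$\tilde S[m,n,k]=\sum_{\sigma\in\tilde S([n^m],k)}q^{\operatorname{inv}\sigma},$$ where $\tilde S[m,n,k]=h_{n-k}([m-1],[2m-1],\dots,[(k+1)m-1])$.
   Context: $[j]=1+q+\dots+q^{j-1}$ ($[0]=0$); $h_j$ is the complete homogeneous symmetric polynomial of degree $j$ ($h_j=0$ for $j<0$). Let $\zeta_m=e^{2\pi i/m}$, $i^c=\zeta_m^c\mathbf e_i$ for $i\in[n]$ (colors mod $m$), $[n^m]=\{0\}\cup\{i^c:i\in[n],0\le c<m\}$, $zS=\{zs:s\in S\}$. A colored set partition of type $(m,n)$ is a set partition of $[n^m]$ into blocks $S_0,\dots,S_{km}$ with (i) $0\in S_0$ and if some $i^c\in S_0$ then all $i^d\in S_0$; (ii) for each $0\le l<k$, $S_{lm+1},\dots,S_{(l+1)m}$ are distinct and of the form $S,\zeta_mS,\dots,\zeta_m^{m-1}S$. A super set partition is such a partition together with, for each base $i$ whose colors lie in $S_0$, a linear ordering of $\{i^0,\dots,i^{m-1}\}$ of the form $i^c,i^{c+1},\dots,i^{c+m-1}$ (exponents mod $m$) with $c\in\{1,\dots,m-1\}$; orderings for different bases are independent, and the blocks $S_1,\dots,S_{km}$ are unordered. $\tilde S([n^m],k)$ is the set of super set partitions with $km+1$ blocks. With $\operatorname{minb}S=0$ if $0\in S$ and otherwise the least base in $S$, the standard form labels blocks so that (ii) holds, $s_i=\operatorname{minb}S_i$ satisfy $0=s_0<s_m<\dots<s_{km}$, and $s_j^{\,r}\in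 S_j$ for $j\in[km]$ with $r=j\bmod m$. The inversions of a super set partition in standard form are (1) pairs $(i^0,S_l)$ with $i^0\in S_j$, $j<l$, $i\ge s_l$, and (2) pairs $(i^0,i^c)$ with $i^0,i^c\in S_0$ and $i^c$ after $i^0$ in the ordering of base $i$; $\operatorname{inv}$ is their number. -}

module Defs where

open import Level using (Level)
open import Data.Bool using (Bool; true; false; if_then_else_; _∧_)
open import Data.Nat using (ℕ; zero; suc; _+_; _*_; _∸_; _≤_; _<_; _≡ᵇ_; _<ᵇ_; _≤ᵇ_)
open import Data.Nat.DivMod using (_%_; _/_; m%n<n)
open import Data.Fin using (Fin; zero; suc; toℕ; fromℕ<)
open import Data.Vec using (Vec; lookup)
open import Data.List using (List; []; _∷_; map; upTo; allFin; foldr; filter; length)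
open import Data.Nat.ListAction using (sum)
open import Data.Bool.ListAction using (any)
open import Data.Product using (Σ; ∃; _×_)
open import Relation.Binary.PropositionalEquality using (_≡_; _≢_)
open import Algebra.Bundles using (CommutativeSemiring)

-- Polynomial side, evaluated in an arbitrary commutative semiring R at q.
-- (An identity for all commutative semirings R and all q ∈ R is the same
-- as the identity in ℕ[q], the free commutative semiring on q.)

module Poly {c ℓ : Level} (R : CommutativeSemiring c ℓ) where
  open CommutativeSemiring R using (Carrier; 0#; 1#) renaming (_+_ to _⊕_; _*_ to _⊗_)

  pow : Carrier → ℕ → Carrier
  pow x zero    = 1#
  pow x (suc e) = x ⊗ pow x e

  sumR : List Carrier → Carrier
  sumR = foldr _⊕_ 0#

  qint : Carrier → ℕ → Carrier
  qint q j = sumR (map (pow q) (upTo j))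

  h : ℕ → List Carrier → Carrier
  h zero    xs       = 1#
  h (suc d) []       = 0#
  h (suc d) (x ∷ xs) = h (suc d) xs ⊕ x ⊗ h d (x ∷ xs)

  -- S̃[m,n,k] = h_{n-k}([m-1],[2m-1],…,[(k+1)m-1]),  h_j = 0 for j < 0
  Stilde : Carrier → ℕ → ℕ → ℕ → Carrier
  Stilde q m n k =
    if k ≤ᵇ n
    then h (n ∸ k) (map (λ j → qint q (suc j * m ∸ 1)) (upTo (suc k)))
    else 0#

-- Super set partitions of [n^m] with km+1 blocks, in standard form.
--
-- Encoding (m = suc m-1 ≥ 1).  Base i ∈ [n] is represented by (x : Fin n)
-- with i = toℕ x + 1; colour c by (c : Fin m).  The element 0 always lies
-- in S₀ and is left implicit.
--   blocks x c = j  means  i^c ∈ S_j   (labels j ∈ {0,…,km} as in standard form)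
--   order x = c     means  the ordering of base i is i^c,i^{c+1},…,i^{c+m-1}
--                   (only for bases in S₀; order x = 0 otherwise, as a
--                   normalisation so that data ↔ super set partitions is 1-1)

record SPData (m n : ℕ) : Set where
  constructor spdata
  field
    blocks : Vec (Vec ℕ m) n
    order  : Vec ℕ n

module SSP (m-1 n k : ℕ) where

  m : ℕ
  m = suc m-1

  blk : SPData m n → Fin n → Fin m → ℕ
  blk d x c = lookup (lookup (SPData.blocks d) x) c

  ord : SPData m n → Fin n → ℕ
  ord d x = lookup (SPData.order d) x

  -- multiplication by ζ_m on colours: c ↦ c+1 mod m
  rot : Fin m → Fin m
  rot c = fromℕ< (m%n<n (suc (toℕ c)) m)

  colourOf : ℕ → Fin m
  colourOf j = fromℕ< (m%n<n j m)

  -- for j ∈ {lm+1,…,lm+m}:  ζ S_j = S_(next j)  (cyclically within the group)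
  next : ℕ → ℕ
  next j = if j % m ≡ᵇ 0 then suc j ∸ m else suc j

  group : ℕ → ℕ
  group j = (j ∸ 1) / m

  InBlock : SPData m n → ℕ → Fin n → Set
  InBlock d j x = ∃ λ c → blk d x c ≡ j

  IsMinb : SPData m n → ℕ → Fin n → Set
  IsMinb d j x = InBlock d j x × (∀ y → InBlock d j y → toℕ x ≤ toℕ y)

  IsSSP : SPData m n → Set
  IsSSP d =
      (∀ x c → blk d x c ≤ k * m)
    × (∀ x c c′ → blk d x c ≡ 0 → blk d x c′ ≡ 0)
      -- (ii): S_{lm+1},…,S_{lm+m} are S, ζS, …, ζ^{m-1}S
    × (∀ x c → 1 ≤ blk d x c → blk d x (rot c) ≡ next (blk d x c))
    × (∀ j → 1 ≤ j → j ≤ k * m →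
         ∃ λ x → IsMinb d j x × blk d x (colourOf j) ≡ j)
      -- standard form: s_m < s_{2m} < … < s_{km}
    × (∀ j j′ x x′ → 1 ≤ j → j ≤ k * m → 1 ≤ j′ → j′ ≤ k * m →
         IsMinb d j x → IsMinb d j′ x′ → group j < group j′ → toℕ x < toℕ x′)
    × (∀ x → (blk d x zero ≡ 0 → 1 ≤ ord d x × ord d x < m)
           × (blk d x zero ≢ 0 → ord d x ≡ 0))

  minbIdx : SPData m n → ℕ → ℕ
  minbIdx d j =
    foldr (λ x acc → if any (λ c → blk d x c ≡ᵇ j) (allFin m) then toℕ x else acc)
          n (allFin n)

  count : {A : Set} → (A → Bool) → List A → ℕ
  count p xs = length (filter (λ a → Data.Bool._≟_ (p a) true) xs)
    where import Data.Bool

  inv₁ : SPData m n → ℕ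
  inv₁ d = sum (map (λ x →
             count (λ l → (blk d x zero <ᵇ l) ∧ (minbIdx d l ≤ᵇ toℕ x))
                   (map suc (upTo (k * m))))
           (allFin n))

  -- position of i^e in the ordering i^c, i^{c+1}, …, i^{c+m-1}
  pos : SPData m n → Fin n → Fin m → ℕ
  pos d x e = (toℕ e + m ∸ ord d x) % m

  inv₂ : SPData m n → ℕ
  inv₂ d = sum (map (λ x →
             if blk d x zero ≡ᵇ 0
             then count (λ e → pos d x zero <ᵇ pos d x e) (allFin m)
             else 0)
           (allFin n))

  inv : SPData m n → ℕ
  inv d = inv₁ d + inv₂ d

{-# OPTIONS --safe #-}
-- Remove the largest base n+1 from a super set partition with km+1 blocks. Either it lies in S₀,
-- with one of the m−1 orderings c, and carries km + c − 1 inversions; or it lies in one of the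
-- km blocks S_j of the remaining super set partition (together with its rotations), carrying the
-- km − j inversions (n+1, S_l) with l > j; or its colours form the last group on their own, it
-- carries no inversion and the rest has k−1 groups. Since it is the largest base, removing it
-- changes no other inversion. Hence, with x_k = [(k+1)m−1] = [km] + q^(km) [m−1],
--   S̃[m,n+1,k] = S̃[m,n,k−1] + x_k S̃[m,n,k],
-- which is the recursion h_d(x₀,…,x_k) = h_d(x₀,…,x_(k−1)) + x_k h_(d−1)(x₀,…,x_k).
module Submission where

open import Defs
open import Level using (Level)
open import Algebra.Bundles using (CommutativeSemiring)
import Algebra.Properties.CommutativeSemigroup as CommutativeSemigroupProperties
open import Data.Bool using (Bool; true; false; T; if_then_else_; _∧_)
import Data.Bool as Bool
open import Data.Bool.ListAction using (any; or)
open import Data.Bool.Properties using (∧-identityʳ; ∧-zeroʳ)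
open import Data.Empty using (⊥-elim)
open import Data.Fin using (Fin; zero; suc; toℕ; fromℕ<; fromℕ; inject₁)
open import Data.Fin.Properties
  using (any?; toℕ-fromℕ<; fromℕ<-toℕ; toℕ<n; toℕ-injective; toℕ-fromℕ; toℕ-inject₁; inject₁ℕ<)
open import Data.Fin.Relation.Unary.Top using (view; ‵fromℕ; ‵inject₁)
open import Data.List
  using (List; []; _∷_; [_]; map; upTo; applyUpTo; _++_; concatMap; length; filter; foldr; tabulate; allFin)
open import Data.List.Properties
  using (map-upTo; map-cong; filter-++; length-++; map-++; map-∘; upTo-∷ʳ; ++-identityʳ; ++-assoc; map-tabulate; foldr-++)
open import Data.List.Membership.Propositional using (_∈_; find; lose)
open import Data.List.Membership.Propositional.Properties
  using (∈-allFin; ∈-map⁺; ∈-map⁻; ∈-++⁺ˡ; ∈-++⁺ʳ; ∈-++⁻; ∈-concatMap⁺; ∈-concatMap⁻; ∈-upTo⁺; ∈-upTo⁻)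
open import Data.List.Relation.Binary.Disjoint.Propositional using (Disjoint)
import Data.List.Relation.Unary.All as All
import Data.List.Relation.Unary.All.Properties as All
import Data.List.Relation.Unary.AllPairs as AllPairs
import Data.List.Relation.Unary.AllPairs.Properties as AllPairs
open import Data.List.Relation.Unary.Any using (here; there)
open import Data.List.Relation.Unary.Any.Properties using (any⁺; any⁻)
open import Data.List.Relation.Unary.Unique.Propositional using (Unique; []; _∷_)
import Data.List.Relation.Unary.Unique.Propositional.Properties as Unique
open import Data.Nat
  using (ℕ; zero; suc; pred; _+_; _*_; _∸_; _⊓_; _≤_; _<_; _≡ᵇ_; _<ᵇ_; _≤ᵇ_; _≟_; _≤?_; _<?_;
         z≤n; s≤s; s≤s⁻¹; NonZero; >-nonZero)
open import Data.Nat.Properties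
open import Data.Nat.DivMod
open import Data.Nat.Divisibility using (n∣m*n)
open import Data.Nat.ListAction using (sum)
open import Data.Nat.ListAction.Properties using (sum-++)
open import Data.Product using (Σ; ∃; ∃₂; _×_; _,_; proj₁; proj₂)
open import Data.Sum using (_⊎_; inj₁; inj₂)
open import Data.Unit using (tt)
open import Data.Vec using (Vec; []; _∷_; _∷ʳ_; lookup; initLast)
import Data.Vec as Vec
open import Data.Vec.Properties using (lookup∘tabulate; tabulate∘lookup; tabulate-cong; ∷ʳ-injective)
open import Function using (_∘_; id)
open import Function.Bundles using (_⇔_; mk⇔)
open import Relation.Binary.Definitions using (tri<; tri≈; tri>)
open import Relation.Binary.PropositionalEquality
  using (_≡_; _≢_; refl; sym; trans; cong; cong₂; subst; subst₂; module ≡-Reasoning)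
open import Relation.Nullary using (¬_; Dec; yes; no)

open CommutativeSemigroupProperties +-commutativeSemigroup using () renaming (interchange to +-interchange)

¬T⇒≡false : ∀ {b} → ¬ T b → b ≡ false
¬T⇒≡false {false} _  = refl
¬T⇒≡false {true}  ¬t = ⊥-elim (¬t tt)

T⇒≡true : ∀ {b} → T b → b ≡ true
T⇒≡true {true} _ = refl

<ᵇ-true : ∀ {a b} → a < b → (a <ᵇ b) ≡ true
<ᵇ-true a<b = T⇒≡true (<⇒<ᵇ a<b)

<ᵇ-false : ∀ {a b} → ¬ a < b → (a <ᵇ b) ≡ false
<ᵇ-false {a} {b} a≮b = ¬T⇒≡false (λ t → a≮b (<ᵇ⇒< a b t))

≤ᵇ-true : ∀ {a b} → a ≤ b → (a ≤ᵇ b) ≡ true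
≤ᵇ-true a≤b = T⇒≡true (≤⇒≤ᵇ a≤b)

≤ᵇ-false : ∀ {a b} → ¬ a ≤ b → (a ≤ᵇ b) ≡ false
≤ᵇ-false {a} {b} a≰b = ¬T⇒≡false (λ t → a≰b (≤ᵇ⇒≤ a b t))

[m+n%d]%d≡[m+n]%d : ∀ a b d .{{_ : NonZero d}} → (a + b % d) % d ≡ (a + b) % d
[m+n%d]%d≡[m+n]%d a b d = begin
  (a + b % d) % d             ≡⟨ %-distribˡ-+ a (b % d) d ⟩
  (a % d + b % d % d) % d     ≡⟨ cong (λ r → (a % d + r) % d) (m%n%n≡m%n b d) ⟩
  (a % d + b % d) % d         ≡⟨ %-distribˡ-+ a b d ⟨
  (a + b) % d                 ∎
  where open ≡-Reasoning

module _ {A : Set} where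

  lookup-∷ʳ-inject₁ : ∀ {n} (xs : Vec A n) y i → lookup (xs ∷ʳ y) (inject₁ i) ≡ lookup xs i
  lookup-∷ʳ-inject₁ (x ∷ xs) y zero    = refl
  lookup-∷ʳ-inject₁ (x ∷ xs) y (suc i) = lookup-∷ʳ-inject₁ xs y i

  lookup-∷ʳ-fromℕ : ∀ {n} (xs : Vec A n) y → lookup (xs ∷ʳ y) (fromℕ n) ≡ y
  lookup-∷ʳ-fromℕ []       y = refl
  lookup-∷ʳ-fromℕ (x ∷ xs) y = lookup-∷ʳ-fromℕ xs y

∈-concatMap⁺′ : ∀ {A B : Set} (f : A → List B) {xs x y} → x ∈ xs → y ∈ f x → y ∈ concatMap f xs
∈-concatMap⁺′ f x∈ y∈ = ∈-concatMap⁺ f (lose x∈ y∈)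

∈-concatMap⁻′ : ∀ {A B : Set} (f : A → List B) xs {y} → y ∈ concatMap f xs → ∃ λ x → x ∈ xs × y ∈ f x
∈-concatMap⁻′ f xs y∈ = find (∈-concatMap⁻ f {xs = xs} y∈)

-- SSP.count does not depend on the parameters of SSP.
count : ∀ {A : Set} → (A → Bool) → List A → ℕ
count = SSP.count 0 0 0

count-∷ : ∀ {A : Set} (p : A → Bool) x xs → count p (x ∷ xs) ≡ (if p x then suc (count p xs) else count p xs)
count-∷ p x xs with p x
... | true  = refl
... | false = refl

count-cong : ∀ {A : Set} (p p′ : A → Bool) xs → (∀ x → x ∈ xs → p x ≡ p′ x) → count p xs ≡ count p′ xs
count-cong p p′ []       _  = refl
count-cong p p′ (x ∷ xs) eq = begin
  count p (x ∷ xs)                                    ≡⟨ count-∷ p x xs ⟩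
  (if p x then suc (count p xs) else count p xs)      ≡⟨ cong₂ (λ b r → if b then suc r else r) (eq x (here refl))
                                                               (count-cong p p′ xs (λ y y∈ → eq y (there y∈))) ⟩
  (if p′ x then suc (count p′ xs) else count p′ xs)   ≡⟨ count-∷ p′ x xs ⟨
  count p′ (x ∷ xs)                                   ∎
  where open ≡-Reasoning

count-++ : ∀ {A : Set} (p : A → Bool) xs ys → count p (xs ++ ys) ≡ count p xs + count p ys
count-++ p xs ys = trans (cong length (filter-++ (λ a → p a Bool.≟ true) xs ys)) (length-++ (filter _ xs))

count-∷-false : ∀ {A : Set} (p : A → Bool) {x} xs → p x ≡ false → count p (x ∷ xs) ≡ count p xs
count-∷-false p {x} xs px = trans (count-∷ p x xs) (cong (λ b → if b then suc (count p xs) else count p xs) px)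

count-none : ∀ {A : Set} (p : A → Bool) xs → (∀ x → x ∈ xs → p x ≡ false) → count p xs ≡ 0
count-none p []       _    = refl
count-none p (x ∷ xs) none = trans (count-∷-false p xs (none x (here refl))) (count-none p xs (λ y y∈ → none y (there y∈)))

count-snoc : ∀ {A : Set} (p : A → Bool) xs x → count p (xs ++ [ x ]) ≡ count p xs + (if p x then 1 else 0)
count-snoc p xs x = trans (count-++ p xs [ x ]) (cong (count p xs +_) (count-∷ p x []))

count-map : ∀ {A B : Set} (p : B → Bool) (f : A → B) xs → count p (map f xs) ≡ count (p ∘ f) xs
count-map p f []       = refl
count-map p f (x ∷ xs) = trans (count-∷ p (f x) (map f xs))
  (trans (cong (λ r → if p (f x) then suc r else r) (count-map p f xs)) (sym (count-∷ (p ∘ f) x xs)))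

count-greater : ∀ v N → count (v <ᵇ_) (map suc (upTo N)) ≡ N ∸ v
count-greater v zero    = sym (0∸n≡0 v)
count-greater v (suc N) = begin
  count (v <ᵇ_) (map suc (upTo (suc N)))                 ≡⟨ cong (count (v <ᵇ_) ∘ map suc) (upTo-∷ʳ N) ⟨
  count (v <ᵇ_) (map suc (upTo N ++ [ N ]))              ≡⟨ cong (count (v <ᵇ_)) (map-++ suc (upTo N) [ N ]) ⟩
  count (v <ᵇ_) (map suc (upTo N) ++ [ suc N ])          ≡⟨ count-snoc (v <ᵇ_) (map suc (upTo N)) (suc N) ⟩
  count (v <ᵇ_) (map suc (upTo N)) + indicator           ≡⟨ cong (_+ indicator) (count-greater v N) ⟩
  N ∸ v + indicator                                      ≡⟨ last (v ≤? N) ⟩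
  suc N ∸ v                                              ∎
  where
  open ≡-Reasoning
  indicator = if v <ᵇ suc N then 1 else 0
  last : Dec (v ≤ N) → N ∸ v + indicator ≡ suc N ∸ v
  last (yes v≤N) rewrite <ᵇ-true (s≤s v≤N) = sym (trans (cong (_∸ v) (+-comm 1 N)) (+-∸-comm 1 v≤N))
  last (no  v≰N) rewrite <ᵇ-false (v≰N ∘ s≤s⁻¹) =
    trans (+-identityʳ _) (trans (m≤n⇒m∸n≡0 (<⇒≤ (≰⇒> v≰N))) (sym (m≤n⇒m∸n≡0 (≰⇒> v≰N))))

count-less : ∀ a N → count (_<ᵇ a) (upTo N) ≡ N ⊓ a
count-less a zero    = refl
count-less a (suc N) = begin
  count (_<ᵇ a) (upTo (suc N))              ≡⟨ cong (count (_<ᵇ a)) (upTo-∷ʳ N) ⟨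
  count (_<ᵇ a) (upTo N ++ [ N ])           ≡⟨ count-snoc (_<ᵇ a) (upTo N) N ⟩
  count (_<ᵇ a) (upTo N) + indicator        ≡⟨ cong (_+ indicator) (count-less a N) ⟩
  N ⊓ a + indicator                         ≡⟨ last (N <? a) ⟩
  suc N ⊓ a                                 ∎
  where
  open ≡-Reasoning
  indicator = if N <ᵇ a then 1 else 0
  last : Dec (N < a) → N ⊓ a + indicator ≡ suc N ⊓ a
  last (yes N<a) rewrite <ᵇ-true N<a | m≤n⇒m⊓n≡m (<⇒≤ N<a) | m≤n⇒m⊓n≡m N<a = +-comm N 1
  last (no  N≮a) rewrite <ᵇ-false N≮a | m≥n⇒m⊓n≡n (≮⇒≥ N≮a) | m≥n⇒m⊓n≡n (m≤n⇒m≤1+n (≮⇒≥ N≮a)) = +-identityʳ a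

upTo-+ : ∀ a b → upTo (a + b) ≡ upTo a ++ map (a +_) (upTo b)
upTo-+ a zero    = trans (cong upTo (+-identityʳ a)) (sym (++-identityʳ (upTo a)))
upTo-+ a (suc b) = begin
  upTo (a + suc b)                                ≡⟨ cong upTo (+-suc a b) ⟩
  upTo (suc (a + b))                              ≡⟨ upTo-∷ʳ (a + b) ⟨
  upTo (a + b) ++ [ a + b ]                       ≡⟨ cong (_++ [ a + b ]) (upTo-+ a b) ⟩
  (upTo a ++ map (a +_) (upTo b)) ++ [ a + b ]    ≡⟨ ++-assoc (upTo a) _ _ ⟩
  upTo a ++ (map (a +_) (upTo b) ++ [ a + b ])    ≡⟨ cong (upTo a ++_) (map-++ (a +_) (upTo b) [ b ]) ⟨
  upTo a ++ map (a +_) (upTo b ++ [ b ])          ≡⟨ cong (λ bs → upTo a ++ map (a +_) bs) (upTo-∷ʳ b) ⟩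
  upTo a ++ map (a +_) (upTo (suc b))             ∎
  where open ≡-Reasoning

tabulate-snoc : ∀ {A : Set} {n} (f : Fin (suc n) → A) → tabulate f ≡ tabulate (f ∘ inject₁) ++ [ f (fromℕ n) ]
tabulate-snoc {n = zero}  f = refl
tabulate-snoc {n = suc n} f = cong (f zero ∷_) (tabulate-snoc (f ∘ suc))

allFin-snoc : ∀ n → allFin (suc n) ≡ map inject₁ (allFin n) ++ [ fromℕ n ]
allFin-snoc n = trans (tabulate-snoc id) (cong (_++ [ fromℕ n ]) (sym (map-tabulate id inject₁)))

map-toℕ-allFin : ∀ n → map toℕ (allFin n) ≡ upTo n
map-toℕ-allFin zero    = refl
map-toℕ-allFin (suc n) = begin
  map toℕ (allFin (suc n))                          ≡⟨ cong (map toℕ) (allFin-snoc n) ⟩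
  map toℕ (map inject₁ (allFin n) ++ [ fromℕ n ])   ≡⟨ map-++ toℕ (map inject₁ (allFin n)) [ fromℕ n ] ⟩
  map toℕ (map inject₁ (allFin n)) ++ [ toℕ (fromℕ n) ]
    ≡⟨ cong₂ (λ xs x → xs ++ [ x ]) (trans (sym (map-∘ (allFin n))) (trans (map-cong toℕ-inject₁ (allFin n)) (map-toℕ-allFin n)))
                                     (toℕ-fromℕ n) ⟩
  upTo n ++ [ n ]                                   ≡⟨ upTo-∷ʳ n ⟩
  upTo (suc n)                                      ∎
  where open ≡-Reasoning

sum-allFin-suc : ∀ {n} (f : Fin (suc n) → ℕ) → sum (map f (allFin (suc n))) ≡ sum (map (f ∘ inject₁) (allFin n)) + f (fromℕ n)
sum-allFin-suc {n} f = begin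
  sum (map f (allFin (suc n)))                                   ≡⟨ cong (sum ∘ map f) (allFin-snoc n) ⟩
  sum (map f (map inject₁ (allFin n) ++ [ fromℕ n ]))            ≡⟨ cong sum (map-++ f (map inject₁ (allFin n)) [ fromℕ n ]) ⟩
  sum (map f (map inject₁ (allFin n)) ++ [ f (fromℕ n) ])        ≡⟨ sum-++ (map f (map inject₁ (allFin n))) [ f (fromℕ n) ] ⟩
  sum (map f (map inject₁ (allFin n))) + (f (fromℕ n) + 0)       ≡⟨ cong₂ _+_ (cong sum (map-∘ (allFin n))) (sym (+-identityʳ _)) ⟨
  sum (map (f ∘ inject₁) (allFin n)) + f (fromℕ n)               ∎
  where open ≡-Reasoning

firstIndex : ∀ {n} → (Fin n → Bool) → ℕ → List (Fin n) → ℕ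
firstIndex p z = foldr (λ x acc → if p x then toℕ x else acc) z

firstIndex-found : ∀ {n} (p : Fin n → Bool) z z′ {xs x} → x ∈ xs → p x ≡ true → firstIndex p z xs ≡ firstIndex p z′ xs
firstIndex-found p z z′ {y ∷ ys} (here refl) px rewrite px = refl
firstIndex-found p z z′ {y ∷ ys} (there x∈) px with p y
... | true  = refl
... | false = firstIndex-found p z z′ x∈ px

firstIndex-none : ∀ {n} (p : Fin n → Bool) z xs → (∀ x → p x ≡ false) → firstIndex p z xs ≡ z
firstIndex-none p z []       _    = refl
firstIndex-none p z (y ∷ ys) none rewrite none y = firstIndex-none p z ys none

firstIndex-≤ : ∀ {n} (p : Fin n → Bool) {z} xs → z ≤ n → firstIndex p z xs ≤ n
firstIndex-≤ p []       z≤ = z≤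
firstIndex-≤ p (y ∷ ys) z≤ with p y
... | true  = <⇒≤ (toℕ<n y)
... | false = firstIndex-≤ p ys z≤

firstIndex-inject₁ : ∀ {n} (p : Fin (suc n) → Bool) (p′ : Fin n → Bool) z xs → (∀ x → p (inject₁ x) ≡ p′ x) →
                     firstIndex p z (map inject₁ xs) ≡ firstIndex p′ z xs
firstIndex-inject₁ p p′ z []       _  = refl
firstIndex-inject₁ p p′ z (y ∷ ys) eq rewrite eq y with p′ y
... | true  = toℕ-inject₁ y
... | false = firstIndex-inject₁ p p′ z ys eq

firstIndex-allFin-suc : ∀ {n} (p : Fin (suc n) → Bool) (p′ : Fin n → Bool) z → (∀ x → p (inject₁ x) ≡ p′ x) →
  firstIndex p z (allFin (suc n)) ≡ firstIndex p′ (if p (fromℕ n) then n else z) (allFin n)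
firstIndex-allFin-suc {n} p p′ z eq = begin
  firstIndex p z (allFin (suc n))                                    ≡⟨ cong (firstIndex p z) (allFin-snoc n) ⟩
  firstIndex p z (map inject₁ (allFin n) ++ [ fromℕ n ])             ≡⟨ foldr-++ _ z (map inject₁ (allFin n)) [ fromℕ n ] ⟩
  firstIndex p (if p (fromℕ n) then toℕ (fromℕ n) else z) (map inject₁ (allFin n))
                                                                     ≡⟨ cong (λ i → firstIndex p (if p (fromℕ n) then i else z) (map inject₁ (allFin n))) (toℕ-fromℕ n) ⟩
  firstIndex p (if p (fromℕ n) then n else z) (map inject₁ (allFin n)) ≡⟨ firstIndex-inject₁ p p′ _ (allFin n) eq ⟩
  firstIndex p′ (if p (fromℕ n) then n else z) (allFin n)            ∎
  where open ≡-Reasoning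

-- The helpers of SSP used here do not depend on its parameters n and k.
module Labels (m-1 : ℕ) where
  open SSP m-1 0 0 public using (m; next; group; rot; colourOf)

  label : ℕ → ℕ → ℕ
  label g s = suc (s + g * m)

  -- By condition (ii), ζ^t S_j = S_(next^ t j) for 1 ≤ j.
  next^ : ℕ → ℕ → ℕ
  next^ zero    j = j
  next^ (suc t) j = next (next^ t j)

  group-label : ∀ g {s} → s < m → group (label g s) ≡ g
  group-label g {s} s<m = begin
    (s + g * m) / m      ≡⟨ +-distrib-/-∣ʳ s (n∣m*n g) ⟩
    s / m + g * m / m    ≡⟨ cong₂ _+_ (m<n⇒m/n≡0 s<m) (m*n/n≡m g m) ⟩
    g                    ∎
    where open ≡-Reasoning

  label-group : ∀ u → label (group (suc u)) (u % m) ≡ suc u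
  label-group u = cong suc (sym (m≡m%n+[m/n]*n u m))

  next-label : ∀ g {s} → s < m → next (label g s) ≡ label g (suc s % m)
  next-label g {s} s<m with m≤n⇒m<n∨m≡n s<m
  ... | inj₁ 1+s<m = begin
    next (label g s)    ≡⟨ cong (λ r → if r ≡ᵇ 0 then suc (label g s) ∸ m else suc (label g s)) label%m ⟩
    label g (suc s)     ≡⟨ cong (label g) (m<n⇒m%n≡m 1+s<m) ⟨
    label g (suc s % m) ∎
    where
    open ≡-Reasoning
    label%m : label g s % m ≡ suc s
    label%m = trans ([m+kn]%n≡m%n (suc s) g m) (m<n⇒m%n≡m 1+s<m)
  ... | inj₂ refl = begin
    next (label g m-1)         ≡⟨ cong (λ r → if r ≡ᵇ 0 then suc (label g m-1) ∸ m else suc (label g m-1)) label%m ⟩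
    suc (m-1 + g * m) ∸ m-1    ≡⟨ cong (_∸ m-1) (+-suc m-1 (g * m)) ⟨
    m-1 + suc (g * m) ∸ m-1    ≡⟨ m+n∸m≡n m-1 (suc (g * m)) ⟩
    label g 0                  ≡⟨ cong (label g) (n%n≡0 m) ⟨
    label g (m % m)            ∎
    where
    open ≡-Reasoning
    label%m : label g m-1 % m ≡ 0
    label%m = trans ([m+kn]%n≡m%n m g m) (n%n≡0 m)

  next^-label : ∀ g {s} → s < m → ∀ t → next^ t (label g s) ≡ label g ((s + t) % m)
  next^-label g {s} s<m zero = cong (label g) (sym (trans (cong (_% m) (+-identityʳ s)) (m<n⇒m%n≡m s<m)))
  next^-label g {s} s<m (suc t) = begin
    next (next^ t (label g s))      ≡⟨ cong next (next^-label g s<m t) ⟩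
    next (label g ((s + t) % m))    ≡⟨ next-label g (m%n<n (s + t) m) ⟩
    label g (suc ((s + t) % m) % m) ≡⟨ cong (label g) ([m+n%d]%d≡[m+n]%d 1 (s + t) m) ⟩
    label g (suc (s + t) % m)       ≡⟨ cong (λ r → label g (r % m)) (+-suc s t) ⟨
    label g ((s + suc t) % m)       ∎
    where open ≡-Reasoning

  next^-zero : ∀ t → next^ t 0 ≡ 0
  next^-zero zero    = refl
  next^-zero (suc t) = trans (cong next (next^-zero t)) (0∸n≡0 m-1)

  next^-suc : ∀ t u → next^ t (suc u) ≡ label (group (suc u)) ((u % m + t) % m)
  next^-suc t u = trans (cong (next^ t) (sym (label-group u))) (next^-label (group (suc u)) (m%n<n u m) t)

  next^-mod : ∀ t u → next^ t u ≡ next^ (t % m) u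
  next^-mod t zero    = trans (next^-zero t) (sym (next^-zero (t % m)))
  next^-mod t (suc u) = begin
    next^ t (suc u)                     ≡⟨ next^-suc t u ⟩
    label g ((u % m + t) % m)           ≡⟨ cong (label g) ([m+n%d]%d≡[m+n]%d (u % m) t m) ⟨
    label g ((u % m + t % m) % m)       ≡⟨ next^-suc (t % m) u ⟨
    next^ (t % m) (suc u)               ∎
    where
    open ≡-Reasoning
    g = group (suc u)

  next^-positive : ∀ t {u} → 1 ≤ u → 1 ≤ next^ t u
  next^-positive t {suc u} _ = subst (1 ≤_) (sym (next^-suc t u)) (s≤s z≤n)

  group-next^ : ∀ t {u} → 1 ≤ u → group (next^ t u) ≡ group u
  group-next^ t {suc u} _ = trans (cong group (next^-suc t u)) (group-label (group (suc u)) (m%n<n (u % m + t) m))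

  ≤*m⇒group< : ∀ {j k} → 1 ≤ j → j ≤ k * m → group j < k
  ≤*m⇒group< {suc j} _ j<km = m<n*o⇒m/o<n j<km

  group<⇒≤*m : ∀ {j k} → 1 ≤ j → group j < k → j ≤ k * m
  group<⇒≤*m {suc j} {k} _ g<k = begin
    suc j                      ≡⟨ label-group j ⟨
    suc (j % m + group (suc j) * m) ≤⟨ +-monoˡ-≤ (group (suc j) * m) (m%n<n j m) ⟩
    suc (group (suc j)) * m    ≤⟨ *-monoˡ-≤ m g<k ⟩
    k * m                      ∎
    where open ≤-Reasoning

  group-of-top-block : ∀ {j} k → k * m < j → j ≤ suc k * m → group j ≡ k
  group-of-top-block {j} k km<j j≤ = ≤-antisym
    (s≤s⁻¹ (≤*m⇒group< 1≤j j≤))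
    (≮⇒≥ λ g<k → <⇒≱ km<j (group<⇒≤*m 1≤j g<k))
    where
    1≤j : 1 ≤ j
    1≤j = ≤-trans (s≤s z≤n) km<j

  same-group⇒next^ : ∀ {u w} → 1 ≤ u → 1 ≤ w → group u ≡ group w → ∃ λ t → next^ t u ≡ w
  same-group⇒next^ {suc u} {suc w} _ _ same = m ∸ u % m + w , (begin
    next^ (m ∸ u % m + w) (suc u)                          ≡⟨ next^-suc _ u ⟩
    label (group (suc u)) ((u % m + (m ∸ u % m + w)) % m) ≡⟨ cong₂ label same (cong (_% m) shift) ⟩
    label (group (suc w)) ((m + w) % m)                    ≡⟨ cong (label (group (suc w))) (trans (cong (_% m) (+-comm m w)) ([m+n]%n≡m%n w m)) ⟩
    label (group (suc w)) (w % m)                          ≡⟨ label-group w ⟩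
    suc w                                                  ∎)
    where
    open ≡-Reasoning
    shift : u % m + (m ∸ u % m + w) ≡ m + w
    shift = trans (sym (+-assoc (u % m) (m ∸ u % m) w)) (cong (_+ w) (m+[n∸m]≡n (m%n≤n u m)))

  next^-colourOf : ∀ {j} → 1 ≤ j → next^ (toℕ (colourOf j)) (suc (group j) * m) ≡ j
  next^-colourOf {suc j} _ = begin
    next^ (toℕ (colourOf (suc j))) (label g m-1) ≡⟨ cong (λ t → next^ t (label g m-1)) (toℕ-fromℕ< (m%n<n (suc j) m)) ⟩
    next^ (suc j % m) (label g m-1)              ≡⟨ next^-mod (suc j) (label g m-1) ⟨
    next^ (suc j) (label g m-1)                  ≡⟨ next^-label g ≤-refl (suc j) ⟩
    label g ((m-1 + suc j) % m)                  ≡⟨ cong (λ r → label g (r % m)) (trans (+-suc m-1 j) (+-comm m j)) ⟩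
    label g ((j + m) % m)                        ≡⟨ cong (label g) ([m+n]%n≡m%n j m) ⟩
    label g (j % m)                              ≡⟨ label-group j ⟩
    suc j                                        ∎
    where
    open ≡-Reasoning
    g = group (suc j)

  next^-≤*m : ∀ t {v k} → v ≤ k * m → next^ t v ≤ k * m
  next^-≤*m t {zero}  _     = subst (_≤ _) (sym (next^-zero t)) z≤n
  next^-≤*m t {suc v} {k} v≤km = group<⇒≤*m (next^-positive t (s≤s z≤n))
    (subst (_< k) (sym (group-next^ t (s≤s z≤n))) (≤*m⇒group< (s≤s z≤n) v≤km))

  next^-positive⁻¹ : ∀ t {v} → 1 ≤ next^ t v → 1 ≤ v
  next^-positive⁻¹ t {zero}  pos = ⊥-elim (<⇒≢ pos (sym (next^-zero t)))
  next^-positive⁻¹ t {suc v} _   = s≤s z≤n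

  next^≡0 : ∀ t {v} → next^ t v ≡ 0 → v ≡ 0
  next^≡0 t {zero}  _  = refl
  next^≡0 t {suc v} eq = ⊥-elim (<⇒≢ (next^-positive t (s≤s z≤n)) (sym eq))

  colourOf-top : ∀ g → colourOf (suc g * m) ≡ zero
  colourOf-top g = toℕ-injective (trans (toℕ-fromℕ< _) (m*n%n≡0 (suc g) m))

module Partitions (m-1 : ℕ) where
  open Labels m-1

  blk : ∀ {n} → SPData m n → Fin n → Fin m → ℕ
  blk {n} = SSP.blk m-1 n 0

  ord : ∀ {n} → SPData m n → Fin n → ℕ
  ord {n} = SSP.ord m-1 n 0

  snoc : ∀ {n} → SPData m n → Vec ℕ m → ℕ → SPData m (suc n)
  snoc (spdata bs os) r o = spdata (bs ∷ʳ r) (os ∷ʳ o)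

  snoc-view : ∀ {n} (d : SPData m (suc n)) → ∃ λ d′ → ∃₂ λ r o → d ≡ snoc d′ r o
  snoc-view (spdata bs os) with initLast bs | initLast os
  ... | bs′ , r , refl | os′ , o , refl = spdata bs′ os′ , r , o , refl

  snoc-injective : ∀ {n} {d d′ : SPData m n} {r r′ o o′} →
                   snoc d r o ≡ snoc d′ r′ o′ → d ≡ d′ × r ≡ r′ × o ≡ o′
  snoc-injective {d = spdata bs os} {spdata bs′ os′} eq
    with ∷ʳ-injective bs bs′ (cong SPData.blocks eq) | ∷ʳ-injective os os′ (cong SPData.order eq)
  ... | refl , r≡r′ | refl , o≡o′ = refl , r≡r′ , o≡o′

  blk-snoc-inject₁ : ∀ {n} (d : SPData m n) r o y c → blk (snoc d r o) (inject₁ y) c ≡ blk d y c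
  blk-snoc-inject₁ (spdata bs os) r o y c = cong (λ row → lookup row c) (lookup-∷ʳ-inject₁ bs r y)

  blk-snoc-fromℕ : ∀ {n} (d : SPData m n) r o c → blk (snoc d r o) (fromℕ n) c ≡ lookup r c
  blk-snoc-fromℕ (spdata bs os) r o c = cong (λ row → lookup row c) (lookup-∷ʳ-fromℕ bs r)

  ord-snoc-inject₁ : ∀ {n} (d : SPData m n) r o y → ord (snoc d r o) (inject₁ y) ≡ ord d y
  ord-snoc-inject₁ (spdata bs os) r o y = lookup-∷ʳ-inject₁ os o y

  ord-snoc-fromℕ : ∀ {n} (d : SPData m n) r o → ord (snoc d r o) (fromℕ n) ≡ o
  ord-snoc-fromℕ (spdata bs os) r o = lookup-∷ʳ-fromℕ os o

  row : ℕ → Vec ℕ m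
  row v = Vec.tabulate (λ c → next^ (toℕ c) v)

  row-unique : ∀ r → (∀ c → lookup r c ≡ next^ (toℕ c) (lookup r zero)) → r ≡ row (lookup r zero)
  row-unique r shape = trans (sym (tabulate∘lookup r)) (tabulate-cong shape)

  IsSSP : ∀ n k → SPData m n → Set
  IsSSP n k = SSP.IsSSP m-1 n k

  InBlock : ∀ {n} → SPData m n → ℕ → Fin n → Set
  InBlock {n} = SSP.InBlock m-1 n 0

  IsMinb : ∀ {n} → SPData m n → ℕ → Fin n → Set
  IsMinb {n} = SSP.IsMinb m-1 n 0

  extend : ∀ {n} → SPData m n → ℕ → ℕ → SPData m (suc n)
  extend d v = snoc d (row v)

  blk-extend-fromℕ : ∀ {n} (d : SPData m n) v o c → blk (extend d v o) (fromℕ n) c ≡ next^ (toℕ c) v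
  blk-extend-fromℕ d v o c = trans (blk-snoc-fromℕ d (row v) o c) (lookup∘tabulate (λ c → next^ (toℕ c) v) c)

  blk-extend-inject₁ : ∀ {n} (d : SPData m n) v o y c → blk (extend d v o) (inject₁ y) c ≡ blk d y c
  blk-extend-inject₁ d v = blk-snoc-inject₁ d (row v)

  ord-extend-inject₁ : ∀ {n} (d : SPData m n) v o y → ord (extend d v o) (inject₁ y) ≡ ord d y
  ord-extend-inject₁ d v = ord-snoc-inject₁ d (row v)

  ord-extend-fromℕ : ∀ {n} (d : SPData m n) v o → ord (extend d v o) (fromℕ n) ≡ o
  ord-extend-fromℕ d v = ord-snoc-fromℕ d (row v)

  extend-injective : ∀ {n} {d d′ : SPData m n} {v v′ o o′} →
                     extend d v o ≡ extend d′ v′ o′ → d ≡ d′ × v ≡ v′ × o ≡ o′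
  extend-injective eq with snoc-injective eq
  ... | d≡d′ , r≡r′ , o≡o′ = d≡d′ , cong (λ r → lookup r zero) r≡r′ , o≡o′

  module Conditions {n k} {d : SPData m n} (ssp : IsSSP n k d) where
    bounded : ∀ x c → blk d x c ≤ k * m
    bounded = proj₁ ssp

    S₀-closed : ∀ x c c′ → blk d x c ≡ 0 → blk d x c′ ≡ 0
    S₀-closed = proj₁ (proj₂ ssp)

    rotation : ∀ x c → 1 ≤ blk d x c → blk d x (rot c) ≡ next (blk d x c)
    rotation = proj₁ (proj₂ (proj₂ ssp))

    standard : ∀ j → 1 ≤ j → j ≤ k * m → ∃ λ x → IsMinb d j x × blk d x (colourOf j) ≡ j
    standard = proj₁ (proj₂ (proj₂ (proj₂ ssp)))

    increasing : ∀ j j′ x x′ → 1 ≤ j → j ≤ k * m → 1 ≤ j′ → j′ ≤ k * m →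
                 IsMinb d j x → IsMinb d j′ x′ → group j < group j′ → toℕ x < toℕ x′
    increasing = proj₁ (proj₂ (proj₂ (proj₂ (proj₂ ssp))))

    orders : ∀ x → (blk d x zero ≡ 0 → 1 ≤ ord d x × ord d x < m) × (blk d x zero ≢ 0 → ord d x ≡ 0)
    orders = proj₂ (proj₂ (proj₂ (proj₂ (proj₂ ssp))))

  module _ {n k} {d : SPData m n} (ssp : IsSSP n k d) where
    open Conditions {k = k} {d = d} ssp

    blk-rot : ∀ x c → blk d x (rot c) ≡ next (blk d x c)
    blk-rot x c with blk d x c in eq
    ... | zero  = trans (S₀-closed x c (rot c) eq) (sym (0∸n≡0 m-1))
    ... | suc _ = trans (rotation x c (subst (1 ≤_) (sym eq) (s≤s z≤n))) (cong next eq)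

    row-shape : ∀ x c → blk d x c ≡ next^ (toℕ c) (blk d x zero)
    row-shape x c = trans (cong (blk d x) (sym (fromℕ<-toℕ c (toℕ<n c)))) (shape (toℕ c) (toℕ<n c))
      where
      shape : ∀ t (t<m : t < m) → blk d x (fromℕ< t<m) ≡ next^ t (blk d x zero)
      shape zero    _     = refl
      shape (suc t) 1+t<m = begin
        blk d x (fromℕ< 1+t<m)   ≡⟨ cong (blk d x) (toℕ-injective toℕ-rot) ⟨
        blk d x (rot cₜ)          ≡⟨ blk-rot x cₜ ⟩
        next (blk d x cₜ)         ≡⟨ cong next (shape t t<m) ⟩
        next^ (suc t) (blk d x zero) ∎
        where
        open ≡-Reasoning
        t<m : t < m
        t<m = <-trans (n<1+n t) 1+t<m
        cₜ = fromℕ< t<m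
        toℕ-rot : toℕ (rot cₜ) ≡ toℕ (fromℕ< 1+t<m)
        toℕ-rot = begin
          toℕ (rot cₜ)       ≡⟨ toℕ-fromℕ< (m%n<n (suc (toℕ cₜ)) m) ⟩
          suc (toℕ cₜ) % m   ≡⟨ cong (λ i → suc i % m) (toℕ-fromℕ< t<m) ⟩
          suc t % m         ≡⟨ m<n⇒m%n≡m 1+t<m ⟩
          suc t             ≡⟨ toℕ-fromℕ< 1+t<m ⟨
          toℕ (fromℕ< 1+t<m) ∎

    meets-group : ∀ x c {j} → 1 ≤ blk d x c → 1 ≤ j → group j ≡ group (blk d x c) → InBlock d j x
    meets-group x c {j} 1≤b 1≤j same = fromℕ< (m%n<n t m) , (begin
      blk d x (fromℕ< (m%n<n t m))     ≡⟨ row-shape x (fromℕ< (m%n<n t m)) ⟩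
      next^ (toℕ (fromℕ< (m%n<n t m))) u ≡⟨ cong (λ s → next^ s u) (toℕ-fromℕ< (m%n<n t m)) ⟩
      next^ (t % m) u                  ≡⟨ next^-mod t u ⟨
      next^ t u                        ≡⟨ u↝j ⟩
      j                                ∎)
      where
      open ≡-Reasoning
      u = blk d x zero
      1≤u : 1 ≤ u
      1≤u = next^-positive⁻¹ (toℕ c) (subst (1 ≤_) (row-shape x c) 1≤b)
      same-u : group u ≡ group j
      same-u = begin
        group u                      ≡⟨ group-next^ (toℕ c) 1≤u ⟨
        group (next^ (toℕ c) u)      ≡⟨ cong group (row-shape x c) ⟨
        group (blk d x c)            ≡⟨ same ⟨
        group j                      ∎
      t : ℕ
      t = proj₁ (same-group⇒next^ 1≤u 1≤j same-u)
      u↝j : next^ t u ≡ j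
      u↝j = proj₂ (same-group⇒next^ 1≤u 1≤j same-u)

  snoc-ssp⇒extend : ∀ {n k} (d : SPData m n) r o → IsSSP (suc n) k (snoc d r o) →
                    snoc d r o ≡ extend d (lookup r zero) o
  snoc-ssp⇒extend {n} {k} d r o ssp = cong (λ r → snoc d r o) (row-unique r λ c → begin
    lookup r c                                        ≡⟨ blk-snoc-fromℕ d r o c ⟨
    blk (snoc d r o) (fromℕ n) c                      ≡⟨ row-shape {k = k} {d = snoc d r o} ssp (fromℕ n) c ⟩
    next^ (toℕ c) (blk (snoc d r o) (fromℕ n) zero)   ≡⟨ cong (next^ (toℕ c)) (blk-snoc-fromℕ d r o zero) ⟩
    next^ (toℕ c) (lookup r zero)                     ∎)
    where open ≡-Reasoning

module Extension (m-1 : ℕ) where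
  open Labels m-1
  open Partitions m-1

  inject₁<fromℕ : ∀ {n} (y : Fin n) → toℕ (inject₁ y) < toℕ (fromℕ n)
  inject₁<fromℕ {n} y = subst (toℕ (inject₁ y) <_) (sym (toℕ-fromℕ n)) (inject₁ℕ< y)

  module _ {n} (d : SPData m n) (v o : ℕ) where
    private
      e = extend d v o

    inBlock⁺ : ∀ {j y} → InBlock d j y → InBlock e j (inject₁ y)
    inBlock⁺ {y = y} (c , eq) = c , trans (blk-extend-inject₁ d v o y c) eq

    inBlock⁻ : ∀ {j y} → InBlock e j (inject₁ y) → InBlock d j y
    inBlock⁻ {y = y} (c , eq) = c , trans (sym (blk-extend-inject₁ d v o y c)) eq

    isMinb⁺ : ∀ {j y} → IsMinb d j y → IsMinb e j (inject₁ y)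
    isMinb⁺ {j} {y} (in-y , least) = inBlock⁺ in-y , bound
      where
      bound : ∀ x → InBlock e j x → toℕ (inject₁ y) ≤ toℕ x
      bound x in-x with view x
      ... | ‵fromℕ     = <⇒≤ (inject₁<fromℕ y)
      ... | ‵inject₁ z = subst₂ _≤_ (sym (toℕ-inject₁ y)) (sym (toℕ-inject₁ z)) (least z (inBlock⁻ in-x))

    isMinb⁻ : ∀ {j y} → IsMinb e j (inject₁ y) → IsMinb d j y
    isMinb⁻ {y = y} (in-y , least) = inBlock⁻ in-y , λ z in-z →
      subst₂ _≤_ (toℕ-inject₁ y) (toℕ-inject₁ z) (least (inject₁ z) (inBlock⁺ in-z))

    fromℕ-not-minb : ∀ {j y} → InBlock d j y → ¬ IsMinb e j (fromℕ n)
    fromℕ-not-minb {y = y} in-y (_ , least) = <⇒≱ (inject₁<fromℕ y) (least (inject₁ y) (inBlock⁺ in-y))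

    extend-bounded : ∀ {K} → (∀ x c → blk d x c ≤ K) → (∀ t → next^ t v ≤ K) → ∀ x c → blk e x c ≤ K
    extend-bounded old new x c with view x
    ... | ‵fromℕ     = subst (_≤ _) (sym (blk-extend-fromℕ d v o c)) (new (toℕ c))
    ... | ‵inject₁ y = subst (_≤ _) (sym (blk-extend-inject₁ d v o y c)) (old y c)

    extend-S₀-closed : (∀ x c c′ → blk d x c ≡ 0 → blk d x c′ ≡ 0) → ∀ x c c′ → blk e x c ≡ 0 → blk e x c′ ≡ 0
    extend-S₀-closed closed x c c′ eq with view x
    ... | ‵fromℕ     = begin
      blk e (fromℕ n) c′ ≡⟨ blk-extend-fromℕ d v o c′ ⟩
      next^ (toℕ c′) v   ≡⟨ cong (next^ (toℕ c′)) (next^≡0 (toℕ c) (trans (sym (blk-extend-fromℕ d v o c)) eq)) ⟩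
      next^ (toℕ c′) 0   ≡⟨ next^-zero (toℕ c′) ⟩
      0                  ∎
      where open ≡-Reasoning
    ... | ‵inject₁ y = trans (blk-extend-inject₁ d v o y c′) (closed y c c′ (trans (sym (blk-extend-inject₁ d v o y c)) eq))

    extend-rotation : (∀ x c → 1 ≤ blk d x c → blk d x (rot c) ≡ next (blk d x c)) →
                      ∀ x c → 1 ≤ blk e x c → blk e x (rot c) ≡ next (blk e x c)
    extend-rotation rotation x c pos with view x
    ... | ‵fromℕ     = begin
      blk e (fromℕ n) (rot c)      ≡⟨ blk-extend-fromℕ d v o (rot c) ⟩
      next^ (toℕ (rot c)) v        ≡⟨ cong (λ t → next^ t v) (toℕ-fromℕ< (m%n<n (suc (toℕ c)) m)) ⟩
      next^ (suc (toℕ c) % m) v    ≡⟨ next^-mod (suc (toℕ c)) v ⟨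
      next (next^ (toℕ c) v)       ≡⟨ cong next (blk-extend-fromℕ d v o c) ⟨
      next (blk e (fromℕ n) c)     ∎
      where open ≡-Reasoning
    ... | ‵inject₁ y = begin
      blk e (inject₁ y) (rot c)    ≡⟨ blk-extend-inject₁ d v o y (rot c) ⟩
      blk d y (rot c)              ≡⟨ rotation y c (subst (1 ≤_) (blk-extend-inject₁ d v o y c) pos) ⟩
      next (blk d y c)             ≡⟨ cong next (blk-extend-inject₁ d v o y c) ⟨
      next (blk e (inject₁ y) c)   ∎
      where open ≡-Reasoning

    extend-orders : (∀ x → (blk d x zero ≡ 0 → 1 ≤ ord d x × ord d x < m) × (blk d x zero ≢ 0 → ord d x ≡ 0)) →
                    (v ≡ 0 → 1 ≤ o × o < m) → (v ≢ 0 → o ≡ 0) →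
                    ∀ x → (blk e x zero ≡ 0 → 1 ≤ ord e x × ord e x < m) × (blk e x zero ≢ 0 → ord e x ≡ 0)
    extend-orders orders in-S₀ not-in-S₀ x with view x
    ... | ‵fromℕ     =
        (λ eq → subst (λ r → 1 ≤ r × r < m) (sym (ord-extend-fromℕ d v o)) (in-S₀ (trans (sym new₀) eq)))
      , (λ ne → trans (ord-extend-fromℕ d v o) (not-in-S₀ (λ v≡0 → ne (trans new₀ v≡0))))
      where
      new₀ : blk e (fromℕ n) zero ≡ v
      new₀ = blk-extend-fromℕ d v o zero
    ... | ‵inject₁ y =
        (λ eq → subst (λ r → 1 ≤ r × r < m) (sym (ord-extend-inject₁ d v o y)) (proj₁ (orders y) (trans (sym old₀) eq)))
      , (λ ne → trans (ord-extend-inject₁ d v o y) (proj₂ (orders y) (λ eq → ne (trans old₀ eq))))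
      where
      old₀ : blk e (inject₁ y) zero ≡ blk d y zero
      old₀ = blk-extend-inject₁ d v o y zero

    extend-ssp : ∀ {k} → IsSSP n k d → v ≤ k * m → (v ≡ 0 → 1 ≤ o × o < m) → (v ≢ 0 → o ≡ 0) →
                 IsSSP (suc n) k e
    extend-ssp {k} (bounded , closed , rotation , standard , increasing , orders) v≤km in-S₀ not-in-S₀ =
        extend-bounded bounded (λ t → next^-≤*m t {k = k} v≤km)
      , extend-S₀-closed closed
      , extend-rotation rotation
      , standard′
      , increasing′
      , extend-orders orders in-S₀ not-in-S₀
      where
      standard′ : ∀ j → 1 ≤ j → j ≤ k * m → ∃ λ x → IsMinb e j x × blk e x (colourOf j) ≡ j
      standard′ j 1≤j j≤km with standard j 1≤j j≤km
      ... | y , minb , coloured = inject₁ y , isMinb⁺ minb , trans (blk-extend-inject₁ d v o y (colourOf j)) coloured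
      occupied : ∀ j → 1 ≤ j → j ≤ k * m → ∃ λ y → InBlock d j y
      occupied j 1≤j j≤km with standard j 1≤j j≤km
      ... | y , (in-y , _) , _ = y , in-y
      increasing′ : ∀ j j′ x x′ → 1 ≤ j → j ≤ k * m → 1 ≤ j′ → j′ ≤ k * m →
                    IsMinb e j x → IsMinb e j′ x′ → group j < group j′ → toℕ x < toℕ x′
      increasing′ j j′ x x′ 1≤j j≤km 1≤j′ j′≤km minb minb′ lt with view x | view x′
      ... | ‵fromℕ     | _           = ⊥-elim (fromℕ-not-minb (proj₂ (occupied j 1≤j j≤km)) minb)
      ... | ‵inject₁ y | ‵fromℕ      = ⊥-elim (fromℕ-not-minb (proj₂ (occupied j′ 1≤j′ j′≤km)) minb′)
      ... | ‵inject₁ y | ‵inject₁ y′ = subst₂ _<_ (sym (toℕ-inject₁ y)) (sym (toℕ-inject₁ y′))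
        (increasing j j′ y y′ 1≤j j≤km 1≤j′ j′≤km (isMinb⁻ minb) (isMinb⁻ minb′) lt)

  inS₀-ssp : ∀ {n k} {d : SPData m n} {i} → i < m-1 → IsSSP n k d → IsSSP (suc n) k (extend d 0 (suc i))
  inS₀-ssp {k = k} {d = d} {i} i<m-1 ssp =
    extend-ssp d 0 (suc i) {k} ssp z≤n (λ _ → s≤s z≤n , s≤s i<m-1) (λ 0≢0 → ⊥-elim (0≢0 refl))

  inBlock-ssp : ∀ {n k} {d : SPData m n} {v} → 1 ≤ v → v ≤ k * m → IsSSP n k d → IsSSP (suc n) k (extend d v 0)
  inBlock-ssp {k = k} {d = d} {v} 1≤v v≤km ssp =
    extend-ssp d v 0 {k} ssp v≤km (λ v≡0 → ⊥-elim (<⇒≢ 1≤v (sym v≡0))) (λ _ → refl)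

  module _ {n k} (d : SPData m n) (ssp : IsSSP n k d) where
    open Conditions {k = k} {d = d} ssp
    private
      v = suc k * m
      e = extend d v 0

      group-new : ∀ {j} c → blk e (fromℕ n) c ≡ j → group j ≡ k
      group-new {j} c eq = begin
        group j                     ≡⟨ cong group eq ⟨
        group (blk e (fromℕ n) c)   ≡⟨ cong group (blk-extend-fromℕ d v 0 c) ⟩
        group (next^ (toℕ c) v)     ≡⟨ group-next^ (toℕ c) (s≤s z≤n) ⟩
        group v                     ≡⟨ group-label k ≤-refl ⟩
        k                           ∎
        where open ≡-Reasoning

      old-≤ : ∀ {j} y c → blk e (inject₁ y) c ≡ j → j ≤ k * m
      old-≤ y c eq = subst (_≤ k * m) (trans (sym (blk-extend-inject₁ d v 0 y c)) eq) (bounded y c)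

    opening-standard : ∀ j → 1 ≤ j → j ≤ suc k * m → ∃ λ x → IsMinb e j x × blk e x (colourOf j) ≡ j
    opening-standard j 1≤j j≤ with j ≤? k * m
    ... | yes j≤km with standard j 1≤j j≤km
    ...   | y , minb , coloured =
      inject₁ y , isMinb⁺ d v 0 minb , trans (blk-extend-inject₁ d v 0 y (colourOf j)) coloured
    opening-standard j 1≤j j≤ | no j≰km = fromℕ n , ((colourOf j , coloured) , least) , coloured
      where
      open ≡-Reasoning
      coloured : blk e (fromℕ n) (colourOf j) ≡ j
      coloured = begin
        blk e (fromℕ n) (colourOf j)                  ≡⟨ blk-extend-fromℕ d v 0 (colourOf j) ⟩
        next^ (toℕ (colourOf j)) (suc k * m)          ≡⟨ cong (λ g → next^ (toℕ (colourOf j)) (suc g * m))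
                                                              (group-of-top-block k (≰⇒> j≰km) j≤) ⟨
        next^ (toℕ (colourOf j)) (suc (group j) * m)  ≡⟨ next^-colourOf 1≤j ⟩
        j                                             ∎
      least : ∀ x → InBlock e j x → toℕ (fromℕ n) ≤ toℕ x
      least x (c , eq) with view x
      ... | ‵fromℕ     = ≤-refl
      ... | ‵inject₁ y = ⊥-elim (j≰km (old-≤ y c eq))

    opening-increasing : ∀ j j′ x x′ → 1 ≤ j → j ≤ suc k * m → 1 ≤ j′ → j′ ≤ suc k * m →
                         IsMinb e j x → IsMinb e j′ x′ → group j < group j′ → toℕ x < toℕ x′
    opening-increasing j j′ x x′ 1≤j _ 1≤j′ _ minb@((c , eq) , _) minb′@((c′ , eq′) , _) lt with view x | view x′
    ... | ‵fromℕ     | ‵fromℕ      = ⊥-elim (<-irrefl (trans (group-new c eq) (sym (group-new c′ eq′))) lt)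
    ... | ‵inject₁ y | ‵fromℕ      = inject₁<fromℕ y
    ... | ‵fromℕ     | ‵inject₁ y′ =
      ⊥-elim (<-asym (subst (_< group j′) (group-new c eq) lt) (≤*m⇒group< 1≤j′ (old-≤ y′ c′ eq′)))
    ... | ‵inject₁ y | ‵inject₁ y′ = subst₂ _<_ (sym (toℕ-inject₁ y)) (sym (toℕ-inject₁ y′))
      (increasing j j′ y y′ 1≤j (old-≤ y c eq) 1≤j′ (old-≤ y′ c′ eq′) (isMinb⁻ d v 0 minb) (isMinb⁻ d v 0 minb′) lt)

    opening-ssp : IsSSP (suc n) (suc k) e
    opening-ssp =
        extend-bounded d v 0 (λ x c → ≤-trans (bounded x c) (m≤n+m (k * m) m)) (λ t → next^-≤*m t {k = suc k} ≤-refl)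
      , extend-S₀-closed d v 0 S₀-closed
      , extend-rotation d v 0 rotation
      , opening-standard
      , opening-increasing
      , extend-orders d v 0 orders (λ ()) (λ _ → refl)

module Classification (m-1 : ℕ) where
  open Labels m-1
  open Partitions m-1
  open Extension m-1

  data Removable {n} (d : SPData m n) : (k v o : ℕ) → Set where
    in-S₀    : ∀ {k i} → i < m-1 → IsSSP n k d → Removable d k 0 (suc i)
    in-block : ∀ {k v} → 1 ≤ v → v ≤ k * m → IsSSP n k d → Removable d k v 0
    opening  : ∀ {k} → IsSSP n k d → Removable d (suc k) (suc k * m) 0

  module Restriction {n k} (d : SPData m n) (v o : ℕ) (ssp : IsSSP (suc n) k (extend d v o)) where
    private
      e = extend d v o
    open Conditions {k = k} {d = e} ssp

    private
      old : ∀ y c → blk e (inject₁ y) c ≡ blk d y c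
      old = blk-extend-inject₁ d v o

      new₀ : blk e (fromℕ n) zero ≡ v
      new₀ = blk-extend-fromℕ d v o zero

      group-new : ∀ {j} c → 1 ≤ v → blk e (fromℕ n) c ≡ j → group j ≡ group v
      group-new {j} c 1≤v eq = trans (cong group (trans (sym eq) (blk-extend-fromℕ d v o c))) (group-next^ (toℕ c) 1≤v)

    restrict-ssp : ∀ {k′} → k′ ≤ k → (∀ y c → blk d y c ≤ k′ * m) →
                   (∀ j → 1 ≤ j → j ≤ k′ * m → ¬ IsMinb e j (fromℕ n)) → IsSSP n k′ d
    restrict-ssp {k′} k′≤k bounded′ new-not-minb =
      bounded′ , closed′ , rotation′ , standard′ , increasing′ , orders′
      where
      k′m≤km : k′ * m ≤ k * m
      k′m≤km = *-monoˡ-≤ m k′≤k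
      closed′ : ∀ y c c′ → blk d y c ≡ 0 → blk d y c′ ≡ 0
      closed′ y c c′ eq = trans (sym (old y c′)) (S₀-closed (inject₁ y) c c′ (trans (old y c) eq))
      rotation′ : ∀ y c → 1 ≤ blk d y c → blk d y (rot c) ≡ next (blk d y c)
      rotation′ y c pos = trans (sym (old y (rot c)))
        (trans (rotation (inject₁ y) c (subst (1 ≤_) (sym (old y c)) pos)) (cong next (old y c)))
      standard′ : ∀ j → 1 ≤ j → j ≤ k′ * m → ∃ λ y → IsMinb d j y × blk d y (colourOf j) ≡ j
      standard′ j 1≤j j≤ with standard j 1≤j (≤-trans j≤ k′m≤km)
      ... | x , minb , coloured with view x
      ...   | ‵fromℕ     = ⊥-elim (new-not-minb j 1≤j j≤ minb)
      ...   | ‵inject₁ y = y , isMinb⁻ d v o minb , trans (sym (old y (colourOf j))) coloured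
      increasing′ : ∀ j j′ y y′ → 1 ≤ j → j ≤ k′ * m → 1 ≤ j′ → j′ ≤ k′ * m →
                    IsMinb d j y → IsMinb d j′ y′ → group j < group j′ → toℕ y < toℕ y′
      increasing′ j j′ y y′ 1≤j j≤ 1≤j′ j′≤ minb minb′ lt = subst₂ _<_ (toℕ-inject₁ y) (toℕ-inject₁ y′)
        (increasing j j′ (inject₁ y) (inject₁ y′) 1≤j (≤-trans j≤ k′m≤km) 1≤j′ (≤-trans j′≤ k′m≤km)
                    (isMinb⁺ d v o minb) (isMinb⁺ d v o minb′) lt)
      orders′ : ∀ y → (blk d y zero ≡ 0 → 1 ≤ ord d y × ord d y < m) × (blk d y zero ≢ 0 → ord d y ≡ 0)
      orders′ y =
          (λ eq → subst (λ r → 1 ≤ r × r < m) (ord-extend-inject₁ d v o y) (proj₁ (orders (inject₁ y)) (trans (old y zero) eq)))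
        , (λ ne → trans (sym (ord-extend-inject₁ d v o y)) (proj₂ (orders (inject₁ y)) (λ eq → ne (trans (sym (old y zero)) eq))))

    old-bounded : ∀ y c → blk d y c ≤ k * m
    old-bounded y c = subst (_≤ k * m) (old y c) (bounded (inject₁ y) c)

    ord-new-S₀ : v ≡ 0 → 1 ≤ o × o < m
    ord-new-S₀ v≡0 = subst (λ r → 1 ≤ r × r < m) (ord-extend-fromℕ d v o) (proj₁ (orders (fromℕ n)) (trans new₀ v≡0))

    ord-new-block : v ≢ 0 → o ≡ 0
    ord-new-block v≢0 = trans (sym (ord-extend-fromℕ d v o)) (proj₂ (orders (fromℕ n)) (λ eq → v≢0 (trans (sym new₀) eq)))

    new-bounded : v ≤ k * m
    new-bounded = subst (_≤ k * m) new₀ (bounded (fromℕ n) zero)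

    S₀-restrict : v ≡ 0 → IsSSP n k d
    S₀-restrict v≡0 = restrict-ssp ≤-refl old-bounded λ j 1≤j _ ((c , eq) , _) →
      <⇒≢ 1≤j (sym (begin
        j                    ≡⟨ eq ⟨
        blk e (fromℕ n) c    ≡⟨ blk-extend-fromℕ d v o c ⟩
        next^ (toℕ c) v      ≡⟨ cong (next^ (toℕ c)) v≡0 ⟩
        next^ (toℕ c) 0      ≡⟨ next^-zero (toℕ c) ⟩
        0                    ∎))
      where open ≡-Reasoning

    -- The old base y meets every block of the new base's group, and y comes before the new base.
    joined-restrict : ∀ {y c} → blk d y c ≡ v → 1 ≤ v → IsSSP n k d
    joined-restrict {y} {c} y∈v 1≤v = restrict-ssp ≤-refl old-bounded λ j 1≤j _ minb@((c′ , eq′) , _) →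
      fromℕ-not-minb d v o (inBlock⁻ d v o (meets-group {k = k} {d = e} ssp (inject₁ y) c (pos) 1≤j (same c′ eq′))) minb
      where
      y∈v′ : blk e (inject₁ y) c ≡ v
      y∈v′ = trans (blk-extend-inject₁ d v o y c) y∈v
      pos : 1 ≤ blk e (inject₁ y) c
      pos = subst (1 ≤_) (sym y∈v′) 1≤v
      same : ∀ {j} c′ → blk e (fromℕ n) c′ ≡ j → group j ≡ group (blk e (inject₁ y) c)
      same c′ eq′ = trans (group-new c′ 1≤v eq′) (cong group (sym y∈v′))

    module Opening (1≤v : 1 ≤ v) (none : ∀ y c → blk d y c ≢ v) where
      private
        g : ℕ
        g = group v

      alone : ∀ y c → 1 ≤ blk d y c → group (blk d y c) ≢ g
      alone y c pos same with meets-group {k = k} {d = e} ssp (inject₁ y) c (subst (1 ≤_) (sym (old y c)) pos) 1≤v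
                                (trans (sym same) (cong group (sym (old y c))))
      ... | c′ , eq = none y c′ (trans (sym (old y c′)) eq)

      g<k : g < k
      g<k = ≤*m⇒group< 1≤v new-bounded

      v≡top : v ≡ suc g * m
      v≡top with standard (suc g * m) (s≤s z≤n) (group<⇒≤*m (s≤s z≤n) (subst (_< k) (sym (group-label g ≤-refl)) g<k))
      ... | x , _ , coloured with view x
      ...   | ‵fromℕ     = trans (sym new₀) (trans (cong (blk e (fromℕ n)) (sym (colourOf-top g))) coloured)
      ...   | ‵inject₁ y = ⊥-elim (alone y zero (subst (1 ≤_) (sym y∈top) (s≤s z≤n))
                                     (trans (cong group y∈top) (group-label g ≤-refl)))
        where
        y∈top : blk d y zero ≡ suc g * m
        y∈top = trans (sym (old y zero)) (trans (cong (blk e (inject₁ y)) (sym (colourOf-top g))) coloured)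

      new-minb : IsMinb e v (fromℕ n)
      new-minb = (zero , new₀) , least
        where
        least : ∀ x → InBlock e v x → toℕ (fromℕ n) ≤ toℕ x
        least x (c , eq) with view x
        ... | ‵fromℕ     = ≤-refl
        ... | ‵inject₁ y = ⊥-elim (none y c (trans (sym (old y c)) eq))

      k′ : ℕ
      k′ = pred k

      k≡1+k′ : k ≡ suc k′
      k≡1+k′ = sym (suc-pred k ⦃ >-nonZero (≤-<-trans z≤n g<k) ⦄)

      -- The new base is the least base of group g, so no group can come after g.
      g≡k′ : g ≡ k′
      g≡k′ with <-cmp g k′
      ... | tri≈ _ g≡k′ _ = g≡k′
      ... | tri> _ _ g>k′ = ⊥-elim (<⇒≱ (subst (g <_) k≡1+k′ g<k) g>k′)
      ... | tri< g<k′ _ _ with standard (suc k′ * m) (s≤s z≤n) (≤-reflexive (cong (_* m) (sym k≡1+k′)))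
      ...   | x , minb , _ with view x
      ...     | ‵fromℕ     = ⊥-elim (<⇒≢ g<k′ (trans (sym (group-new _ 1≤v (proj₂ (proj₁ minb)))) (group-label k′ ≤-refl)))
      ...     | ‵inject₁ y = ⊥-elim (<⇒≱ (inject₁<fromℕ y) (<⇒≤
          (increasing v (suc k′ * m) (fromℕ n) (inject₁ y) 1≤v new-bounded (s≤s z≤n)
                      (≤-reflexive (cong (_* m) (sym k≡1+k′))) new-minb minb
                      (subst (g <_) (sym (group-label k′ ≤-refl)) g<k′))))

      old-bounded′ : ∀ y c → blk d y c ≤ k′ * m
      old-bounded′ y c with blk d y c in eq
      ... | zero  = z≤n
      ... | suc b with suc b ≤? k′ * m
      ...   | yes b≤ = b≤
      ...   | no  b≰ = ⊥-elim (alone y c (subst (1 ≤_) (sym eq) (s≤s z≤n)) (trans (cong group eq)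
                 (trans (group-of-top-block k′ (≰⇒> b≰) (subst (λ k → suc b ≤ k * m) k≡1+k′
                          (subst (_≤ k * m) eq (old-bounded y c)))) (sym g≡k′))))

      opening-restrict : ∃ λ k′ → k ≡ suc k′ × v ≡ suc k′ * m × IsSSP n k′ d
      opening-restrict = k′ , k≡1+k′ , trans v≡top (cong (λ g → suc g * m) g≡k′) ,
        restrict-ssp (subst (k′ ≤_) (sym k≡1+k′) (n≤1+n k′)) old-bounded′ λ j 1≤j j≤ ((c , eq) , _) →
          <⇒≢ (≤*m⇒group< 1≤j j≤) (trans (group-new c 1≤v eq) g≡k′)

  classify : ∀ {n k} (d : SPData m n) v o → IsSSP (suc n) k (extend d v o) → Removable d k v o
  classify {k = k} d zero zero ssp = ⊥-elim (1+n≰n (proj₁ (ord-new-S₀ refl)))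
    where open Restriction {k = k} d 0 0 ssp
  classify {k = k} d zero (suc i) ssp = in-S₀ (s≤s⁻¹ (proj₂ (ord-new-S₀ refl))) (S₀-restrict refl)
    where open Restriction {k = k} d 0 (suc i) ssp
  classify {k = k} d (suc v) (suc o) ssp = ⊥-elim (1+n≢0 (ord-new-block 1+n≢0))
    where open Restriction {k = k} d (suc v) (suc o) ssp
  classify {k = k} d (suc v) zero ssp with any? (λ y → any? (λ c → blk d y c ≟ suc v))
  ... | yes (y , c , y∈v) = in-block (s≤s z≤n) new-bounded (joined-restrict y∈v (s≤s z≤n))
    where open Restriction {k = k} d (suc v) 0 ssp
  ... | no  none with Restriction.Opening.opening-restrict {k = k} d (suc v) 0 ssp (s≤s z≤n) (λ y c y∈v → none (y , c , y∈v))
  ...   | k′ , refl , v≡ , ssp′ = subst (λ v → Removable d (suc k′) v 0) (sym v≡) (opening ssp′)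

module Enumeration (m-1 : ℕ) where
  open Labels m-1
  open Partitions m-1
  open Extension m-1
  open Classification m-1

  ssp-groups-≤ : ∀ {n k k′} {d : SPData m n} → IsSSP n k d → IsSSP n k′ d → k′ ≤ k
  ssp-groups-≤ {k = k} {k′} (bounded , _) (_ , _ , _ , standard , _) = ≮⇒≥ λ k<k′ →
    let x , _ , coloured = standard (k′ * m) (*-mono-≤ (≤-trans (s≤s z≤n) k<k′) (s≤s z≤n)) ≤-refl
    in <⇒≱ (*-monoˡ-< m k<k′) (subst (_≤ k * m) coloured (bounded x _))

  ssp-groups-unique : ∀ {n k k′} {d : SPData m n} → IsSSP n k d → IsSSP n k′ d → k ≡ k′
  ssp-groups-unique {k = k} {k′} {d} ssp ssp′ =
    ≤-antisym (ssp-groups-≤ {k = k′} {k} {d} ssp′ ssp) (ssp-groups-≤ {k = k} {k′} {d} ssp ssp′)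

  joinS₀ : ∀ {n} → SPData m n → ℕ → SPData m (suc n)
  joinS₀ d i = extend d 0 (suc i)

  joinBlock : ∀ {n} → ℕ → SPData m n → ℕ → SPData m (suc n)
  joinBlock k d i = extend d (k * m ∸ i) 0

  openGroup : ∀ {n} → ℕ → SPData m n → SPData m (suc n)
  openGroup k d = extend d (suc k * m) 0

  extensions : ∀ {n} → ℕ → SPData m n → List (SPData m (suc n))
  extensions k d = map (joinS₀ d) (upTo m-1) ++ map (joinBlock k d) (upTo (k * m))

  ssps : ∀ n → ℕ → List (SPData m n)
  openings : ∀ n → ℕ → List (SPData m (suc n))
  ssps zero    zero    = spdata [] [] ∷ []
  ssps zero    (suc k) = []
  ssps (suc n) k       = openings n k ++ concatMap (extensions k) (ssps n k)
  openings n zero    = []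
  openings n (suc k) = map (openGroup k) (ssps n k)

  ∈extensions⁻ : ∀ {n} k (d : SPData m n) {e} → e ∈ extensions k d →
                 (∃ λ i → i < m-1 × e ≡ joinS₀ d i) ⊎ (∃ λ i → i < k * m × e ≡ joinBlock k d i)
  ∈extensions⁻ k d e∈ with ∈-++⁻ (map (joinS₀ d) (upTo m-1)) e∈
  ... | inj₁ e∈S₀     = let i , i∈ , e≡ = ∈-map⁻ (joinS₀ d) e∈S₀ in inj₁ (i , ∈-upTo⁻ i∈ , e≡)
  ... | inj₂ e∈blocks = let i , i∈ , e≡ = ∈-map⁻ (joinBlock k d) e∈blocks in inj₂ (i , ∈-upTo⁻ i∈ , e≡)

  empty-ssp : IsSSP 0 0 (spdata [] [])
  empty-ssp = (λ ()) , (λ ()) , (λ ()) , (λ { _ (s≤s _) () }) , (λ { _ _ _ _ (s≤s _) () }) , (λ ())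

  ssps-sound : ∀ n k {d} → d ∈ ssps n k → IsSSP n k d
  ssps-sound zero zero (here refl) = empty-ssp
  ssps-sound (suc n) k d∈ with ∈-++⁻ (openings n k) d∈
  ssps-sound (suc n) (suc k) _ | inj₁ d∈ with ∈-map⁻ (openGroup k) d∈
  ... | d′ , d′∈ , refl = opening-ssp {k = k} d′ (ssps-sound n k d′∈)
  ssps-sound (suc n) k _ | inj₂ d∈ with ∈-concatMap⁻′ (extensions k) (ssps n k) d∈
  ... | d′ , d′∈ , e∈ with ∈extensions⁻ k d′ e∈
  ...   | inj₁ (i , i<m-1 , refl) = inS₀-ssp {k = k} {d = d′} i<m-1 (ssps-sound n k d′∈)
  ...   | inj₂ (i , i<km , refl)  =
    inBlock-ssp {k = k} {d = d′} (m<n⇒0<n∸m i<km) (m∸n≤m (k * m) i) (ssps-sound n k d′∈)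

  ssps-complete : ∀ n k (d : SPData m n) → IsSSP n k d → d ∈ ssps n k
  ssps-complete zero zero (spdata [] []) _ = here refl
  ssps-complete zero (suc k) d (_ , _ , _ , standard , _) with standard 1 (s≤s z≤n) (s≤s z≤n)
  ... | () , _
  ssps-complete (suc n) k d ssp with snoc-view d
  ... | d′ , r , o , refl = subst (_∈ ssps (suc n) k) (sym d≡)
          (member (classify d′ (lookup r zero) o (subst (IsSSP (suc n) k) d≡ ssp)))
    where
    d≡ : snoc d′ r o ≡ extend d′ (lookup r zero) o
    d≡ = snoc-ssp⇒extend {k = k} d′ r o ssp
    member : ∀ {k v o} → Removable d′ k v o → extend d′ v o ∈ ssps (suc n) k
    member {k} (in-S₀ i<m-1 ssp′) = ∈-++⁺ʳ (openings n k) (∈-concatMap⁺′ (extensions k)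
      (ssps-complete n k d′ ssp′) (∈-++⁺ˡ (∈-map⁺ (joinS₀ d′) (∈-upTo⁺ i<m-1))))
    member {k} {v} (in-block 1≤v v≤km ssp′) = ∈-++⁺ʳ (openings n k) (∈-concatMap⁺′ (extensions k)
      (ssps-complete n k d′ ssp′) (∈-++⁺ʳ (map (joinS₀ d′) (upTo m-1))
        (subst (λ v → extend d′ v 0 ∈ map (joinBlock k d′) (upTo (k * m))) (m∸[m∸n]≡n v≤km)
          (∈-map⁺ (joinBlock k d′) (∈-upTo⁺ (∸-monoʳ-< 1≤v v≤km))))))
    member (opening {k} ssp′) = ∈-++⁺ˡ (∈-map⁺ (openGroup k) (ssps-complete n k d′ ssp′))

  extensions-unique : ∀ {n} k (d : SPData m n) → Unique (extensions k d)
  extensions-unique k d = Unique.++⁺ S₀-unique blocks-unique disjoint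
    where
    S₀-unique : Unique (map (joinS₀ d) (upTo m-1))
    S₀-unique = Unique.map⁺ (λ eq → suc-injective (proj₂ (proj₂ (extend-injective eq)))) (Unique.upTo⁺ m-1)
    blocks-unique : Unique (map (joinBlock k d) (upTo (k * m)))
    blocks-unique = subst Unique (sym (map-upTo (joinBlock k d) (k * m)))
      (Unique.applyUpTo⁺₁ (joinBlock k d) (k * m) λ i<j j<km eq →
        <⇒≢ i<j (∸-cancelˡ-≡ (<⇒≤ (<-trans i<j j<km)) (<⇒≤ j<km) (proj₁ (proj₂ (extend-injective eq)))))
    disjoint : Disjoint (map (joinS₀ d) (upTo m-1)) (map (joinBlock k d) (upTo (k * m)))
    disjoint (e∈S₀ , e∈blocks) with ∈-map⁻ (joinS₀ d) e∈S₀ | ∈-map⁻ (joinBlock k d) e∈blocks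
    ... | _ , _ , refl | _ , _ , eq = 1+n≢0 (proj₂ (proj₂ (extend-injective eq)))

  ∈extensions⇒extend : ∀ {n} k (d : SPData m n) {e} → e ∈ extensions k d → ∃₂ λ v o → e ≡ extend d v o
  ∈extensions⇒extend k d e∈ with ∈extensions⁻ k d e∈
  ... | inj₁ (i , _ , e≡) = 0 , suc i , e≡
  ... | inj₂ (i , _ , e≡) = k * m ∸ i , 0 , e≡

  ∈extensions⇒base : ∀ {n} k {d d′ : SPData m n} {e} → e ∈ extensions k d → e ∈ extensions k d′ → d ≡ d′
  ∈extensions⇒base k {d} {d′} e∈ e∈′ =
    let _ , _ , e≡ = ∈extensions⇒extend k d e∈ ; _ , _ , e≡′ = ∈extensions⇒extend k d′ e∈′
    in proj₁ (extend-injective (trans (sym e≡) e≡′))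

  openings-disjoint : ∀ n k → Disjoint (openings n k) (concatMap (extensions k) (ssps n k))
  openings-disjoint n (suc k) (e∈o , e∈c)
    with ∈-map⁻ (openGroup k) e∈o | ∈-concatMap⁻′ (extensions (suc k)) (ssps n (suc k)) e∈c
  ... | d , d∈ , refl | d′ , d′∈ , e∈ with ∈extensions⇒extend (suc k) d′ e∈
  ...   | _ , _ , e≡ with proj₁ (extend-injective e≡)
  ...     | refl = <⇒≢ (n<1+n k) (ssp-groups-unique {d = d} (ssps-sound n k d∈) (ssps-sound n (suc k) d′∈))

  ssps-unique : ∀ n k → Unique (ssps n k)
  openings-unique : ∀ n k → Unique (openings n k)
  ssps-unique zero    zero    = All.[] ∷ []
  ssps-unique zero    (suc k) = []
  ssps-unique (suc n) k       = Unique.++⁺ (openings-unique n k) extensions-unique′ (openings-disjoint n k)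
    where
    extensions-unique′ : Unique (concatMap (extensions k) (ssps n k))
    extensions-unique′ = Unique.concat⁺
      (All.map⁺ (All.universal (extensions-unique k) (ssps n k)))
      (AllPairs.map⁺ (AllPairs.map (λ d≢d′ {_} (e∈ , e∈′) → d≢d′ (∈extensions⇒base k e∈ e∈′)) (ssps-unique n k)))
  openings-unique n zero    = []
  openings-unique n (suc k) = Unique.map⁺ (λ eq → proj₁ (extend-injective eq)) (ssps-unique n k)

module Inversions (m-1 : ℕ) where
  open Labels m-1
  open Partitions m-1
  open Enumeration m-1 using (joinS₀; joinBlock; openGroup)

  inv : ∀ {n} → ℕ → SPData m n → ℕ
  inv {n} k = SSP.inv m-1 n k

  minbIdx : ∀ {n} → SPData m n → ℕ → ℕ
  minbIdx {n} = SSP.minbIdx m-1 n 0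

  -- The contributions of a single base to SSP.inv₁ and SSP.inv₂.
  blockInversions : ∀ {n} → ℕ → SPData m n → Fin n → ℕ
  blockInversions k d x = count (λ l → (blk d x zero <ᵇ l) ∧ (minbIdx d l ≤ᵇ toℕ x)) (map suc (upTo (k * m)))

  orderInversions : ℕ → ℕ → ℕ
  orderInversions b o =
    if b ≡ᵇ 0 then count (λ (c : Fin m) → (toℕ (zero {m-1}) + m ∸ o) % m <ᵇ (toℕ c + m ∸ o) % m) (allFin m) else 0

  private
    module Ordering {i} (i<m-1 : i < m-1) where
      o : ℕ
      o = suc i

      A : ℕ
      A = m ∸ o

      o≤m : o ≤ m
      o≤m = s≤s (<⇒≤ i<m-1)

      A<m : A < m
      A<m = ∸-monoʳ-< {o = 0} (s≤s z≤n) o≤m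

      -- later t: colour t comes after colour 0 in the ordering i^o, i^(o+1), …; colour 0 has position A.
      later : ℕ → Bool
      later t = (0 + m ∸ o) % m <ᵇ (t + m ∸ o) % m

      shift : ∀ t → t + m ∸ o ≡ A + t
      shift t = trans (cong (_∸ o) (+-comm t m)) (+-∸-comm t o≤m)

      later-suc : ∀ t → t < m-1 → later (suc t) ≡ (t <ᵇ i)
      later-suc t t<m-1 with t <? i
      ... | yes t<i = trans (cong₂ _<ᵇ_ (m<n⇒m%n≡m A<m) (trans (cong (_% m) (shift (suc t))) (m<n⇒m%n≡m no-wrap)))
                            (trans (<ᵇ-true (m<m+n A (s≤s z≤n))) (sym (<ᵇ-true t<i)))
        where
        no-wrap : A + suc t < m
        no-wrap = subst (A + suc t <_) (m∸n+n≡m o≤m) (+-monoʳ-< A (s≤s t<i))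
      ... | no  t≮i = trans (cong₂ _<ᵇ_ (m<n⇒m%n≡m A<m) (trans (cong (_% m) (shift (suc t))) wrap))
                            (trans (<ᵇ-false (<⇒≱ before ∘ <⇒≤)) (sym (<ᵇ-false t≮i)))
        where
        open ≡-Reasoning
        o≤1+t : o ≤ suc t
        o≤1+t = s≤s (≮⇒≥ t≮i)
        wrap : (A + suc t) % m ≡ suc t ∸ o
        wrap = begin
          (A + suc t) % m            ≡⟨ cong (_% m) (+-∸-comm (suc t) o≤m) ⟨
          (m + suc t ∸ o) % m        ≡⟨ cong (λ r → (r ∸ o) % m) (+-comm m (suc t)) ⟩
          (suc t + m ∸ o) % m        ≡⟨ cong (_% m) (+-∸-comm m o≤1+t) ⟩
          (suc t ∸ o + m) % m        ≡⟨ [m+n]%n≡m%n (suc t ∸ o) m ⟩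
          (suc t ∸ o) % m            ≡⟨ m<n⇒m%n≡m (≤-<-trans (m∸n≤m (suc t) o) (s≤s t<m-1)) ⟩
          suc t ∸ o                  ∎
        before : suc t ∸ o < A
        before = ∸-monoˡ-< (s≤s t<m-1) o≤1+t

  orderInversions-S₀ : ∀ {i} → i < m-1 → orderInversions 0 (suc i) ≡ i
  orderInversions-S₀ {i} i<m-1 = begin
    count (later ∘ toℕ) (allFin m)             ≡⟨ count-map later toℕ (allFin m) ⟨
    count later (map toℕ (allFin m))           ≡⟨ cong (count later) (map-toℕ-allFin m) ⟩
    count later (0 ∷ applyUpTo suc m-1)        ≡⟨ cong (count later ∘ (0 ∷_)) (map-upTo suc m-1) ⟨
    count later (0 ∷ map suc (upTo m-1))       ≡⟨ count-∷-false later {0} (map suc (upTo m-1)) (<ᵇ-false {A % m} (<-irrefl refl)) ⟩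
    count later (map suc (upTo m-1))           ≡⟨ count-map later suc (upTo m-1) ⟩
    count (later ∘ suc) (upTo m-1)             ≡⟨ count-cong (later ∘ suc) (_<ᵇ i) (upTo m-1) (λ t t∈ → later-suc t (∈-upTo⁻ t∈)) ⟩
    count (_<ᵇ i) (upTo m-1)                   ≡⟨ count-less i m-1 ⟩
    m-1 ⊓ i                                    ≡⟨ m≥n⇒m⊓n≡n (<⇒≤ i<m-1) ⟩
    i                                          ∎
    where
    open ≡-Reasoning
    open Ordering i<m-1

  orderInversions-block : ∀ {b} o → 1 ≤ b → orderInversions b o ≡ 0
  orderInversions-block {suc b} o _ = refl

  -- The test used by SSP.minbIdx.
  inBlockᵇ : ∀ {n} → SPData m n → ℕ → Fin n → Bool
  inBlockᵇ d l x = any (λ c → blk d x c ≡ᵇ l) (allFin m)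

  inBlockᵇ-true : ∀ {n} (d : SPData m n) {l y} → InBlock d l y → inBlockᵇ d l y ≡ true
  inBlockᵇ-true d {l} (c , eq) = T⇒≡true (any⁺ _ (lose (∈-allFin c) (≡⇒≡ᵇ _ l eq)))

  inBlockᵇ-false : ∀ {n} (d : SPData m n) {l y} → (∀ c → blk d y c ≢ l) → inBlockᵇ d l y ≡ false
  inBlockᵇ-false d {l} {y} none = ¬T⇒≡false λ t →
    let c , _ , eq = find (any⁻ (λ c → blk d y c ≡ᵇ l) (allFin m) t) in none c (≡ᵇ⇒≡ _ l eq)

  module _ {n} (d : SPData m n) (v o : ℕ) where
    private
      e = extend d v o

    minbIdx-extend : ∀ l → ∃ λ z → n ≤ z × minbIdx e l ≡ firstIndex (inBlockᵇ d l) z (allFin n)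
    minbIdx-extend l = (if inBlockᵇ e l (fromℕ n) then n else suc n) , default≥n (inBlockᵇ e l (fromℕ n)) ,
      firstIndex-allFin-suc (inBlockᵇ e l) (inBlockᵇ d l) (suc n)
        (λ x → cong or (map-cong (λ c → cong (_≡ᵇ l) (blk-extend-inject₁ d v o x c)) (allFin m)))
      where
      default≥n : ∀ b → n ≤ (if b then n else suc n)
      default≥n true  = ≤-refl
      default≥n false = n≤1+n n

    minbIdx-extend-occupied : ∀ {l y} → InBlock d l y → minbIdx e l ≡ minbIdx d l
    minbIdx-extend-occupied {l} {y} in-y = let z , _ , eq = minbIdx-extend l in
      trans eq (firstIndex-found (inBlockᵇ d l) z n (∈-allFin y) (inBlockᵇ-true d in-y))

    minbIdx-extend-occupied-≤ : ∀ {l y} → InBlock d l y → minbIdx e l ≤ n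
    minbIdx-extend-occupied-≤ {l} in-y =
      subst (_≤ n) (sym (minbIdx-extend-occupied in-y)) (firstIndex-≤ (inBlockᵇ d l) (allFin n) ≤-refl)

    minbIdx-extend-empty : ∀ {l} → (∀ y c → blk d y c ≢ l) → n ≤ minbIdx e l
    minbIdx-extend-empty {l} none = let z , n≤z , eq = minbIdx-extend l in
      subst (n ≤_) (sym (trans eq (firstIndex-none (inBlockᵇ d l) z (allFin n) (λ y → inBlockᵇ-false d (none y))))) n≤z

    inv-extend : ∀ {k K} → (∀ y → blockInversions K e (inject₁ y) ≡ blockInversions k d y) →
                 inv K e ≡ inv k d + (blockInversions K e (fromℕ n) + orderInversions v o)
    inv-extend {k} {K} old = begin
      inv K e
        ≡⟨ cong₂ _+_ (sum-allFin-suc (blockInversions K e)) (sum-allFin-suc orderInversionsₑ) ⟩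
      (sum (map (blockInversions K e ∘ inject₁) (allFin n)) + blockInversions K e (fromℕ n)) +
      (sum (map (orderInversionsₑ ∘ inject₁) (allFin n)) + orderInversionsₑ (fromℕ n))
        ≡⟨ cong₂ _+_ (cong (_+ _) (cong sum (map-cong old (allFin n))))
                     (cong₂ _+_ (cong sum (map-cong old₂ (allFin n))) new₂) ⟩
      (SSP.inv₁ m-1 n k d + blockInversions K e (fromℕ n)) + (SSP.inv₂ m-1 n k d + orderInversions v o)
        ≡⟨ +-interchange (SSP.inv₁ m-1 n k d) _ (SSP.inv₂ m-1 n k d) _ ⟩
      inv k d + (blockInversions K e (fromℕ n) + orderInversions v o)
        ∎
      where
      open ≡-Reasoning
      orderInversionsₑ : Fin (suc n) → ℕ
      orderInversionsₑ x = orderInversions (blk e x zero) (ord e x)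
      old₂ : ∀ y → orderInversionsₑ (inject₁ y) ≡ orderInversions (blk d y zero) (ord d y)
      old₂ y = cong₂ orderInversions (blk-extend-inject₁ d v o y zero) (ord-extend-inject₁ d v o y)
      new₂ : orderInversionsₑ (fromℕ n) ≡ orderInversions v o
      new₂ = cong₂ orderInversions (blk-extend-fromℕ d v o zero) (ord-extend-fromℕ d v o)

  module _ {n k} {d : SPData m n} (ssp : IsSSP n k d) where
    open Conditions {k = k} {d = d} ssp using (bounded; standard)

    occupied : ∀ {l} → l ∈ map suc (upTo (k * m)) → ∃ λ y → InBlock d l y
    occupied l∈ with ∈-map⁻ suc l∈
    ... | t , t∈ , refl = let y , (in-y , _) , _ = standard (suc t) (s≤s z≤n) (∈-upTo⁻ t∈) in y , in-y

    blockInversions-extend-old : ∀ v o y → blockInversions k (extend d v o) (inject₁ y) ≡ blockInversions k d y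
    blockInversions-extend-old v o y = count-cong _ _ (map suc (upTo (k * m))) λ l l∈ →
      cong₂ _∧_ (cong (_<ᵇ l) (blk-extend-inject₁ d v o y zero))
                (cong₂ _≤ᵇ_ (minbIdx-extend-occupied d v o (proj₂ (occupied l∈))) (toℕ-inject₁ y))

    blockInversions-extend-new : ∀ v o → blockInversions k (extend d v o) (fromℕ n) ≡ k * m ∸ v
    blockInversions-extend-new v o = trans (count-cong _ (v <ᵇ_) (map suc (upTo (k * m))) λ l l∈ →
        trans (cong₂ _∧_ (cong (_<ᵇ l) (blk-extend-fromℕ d v o zero))
                         (≤ᵇ-true (subst (minbIdx (extend d v o) l ≤_) (sym (toℕ-fromℕ n))
                                          (minbIdx-extend-occupied-≤ d v o (proj₂ (occupied l∈))))))
              (∧-identityʳ (v <ᵇ l)))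
      (count-greater v (k * m))

    inv-joinS₀ : ∀ {i} → i < m-1 → inv k (joinS₀ d i) ≡ inv k d + (k * m + i)
    inv-joinS₀ {i} i<m-1 = trans (inv-extend d 0 (suc i) {k} {k} (blockInversions-extend-old 0 (suc i)))
      (cong (inv k d +_) (cong₂ _+_ (blockInversions-extend-new 0 (suc i)) (orderInversions-S₀ i<m-1)))

    inv-joinBlock : ∀ {i} → i < k * m → inv k (joinBlock k d i) ≡ inv k d + i
    inv-joinBlock {i} i<km = trans (inv-extend d v 0 {k} {k} (blockInversions-extend-old v 0))
      (cong (inv k d +_) (trans (cong₂ _+_ (trans (blockInversions-extend-new v 0) (m∸[m∸n]≡n (<⇒≤ i<km)))
                                           (orderInversions-block 0 (m<n⇒0<n∸m i<km)))
                                (+-identityʳ i)))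
      where v = k * m ∸ i

    inv-openGroup : inv (suc k) (openGroup k d) ≡ inv k d
    inv-openGroup = begin
      inv (suc k) e                                           ≡⟨ inv-extend d v 0 {k} {suc k} old ⟩
      inv k d + (blockInversions (suc k) e (fromℕ n) + orderInversions v 0)
                                                              ≡⟨ cong (inv k d +_) (cong₂ _+_ new (orderInversions-block {v} 0 (s≤s z≤n))) ⟩
      inv k d + 0                                             ≡⟨ +-identityʳ _ ⟩
      inv k d                                                 ∎
      where
      open ≡-Reasoning
      v = suc k * m
      e = extend d v 0
      new : blockInversions (suc k) e (fromℕ n) ≡ 0
      new = count-none _ (map suc (upTo v)) λ l l∈ → let t , t∈ , l≡ = ∈-map⁻ suc l∈ in
        cong (_∧ (minbIdx e l ≤ᵇ toℕ (fromℕ n))) (trans (cong (_<ᵇ l) (blk-extend-fromℕ d v 0 zero))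
          (<ᵇ-false (≤⇒≯ (subst (_≤ v) (sym l≡) (∈-upTo⁻ t∈)))))
      top : List ℕ
      top = map suc (map (k * m +_) (upTo m))
      range : map suc (upTo v) ≡ map suc (upTo (k * m)) ++ top
      range = trans (cong (map suc) (trans (cong upTo (+-comm m (k * m))) (upTo-+ (k * m) m)))
                    (map-++ suc (upTo (k * m)) (map (k * m +_) (upTo m)))
      old : ∀ y → blockInversions (suc k) e (inject₁ y) ≡ blockInversions k d y
      old y = begin
        count p (map suc (upTo v))                          ≡⟨ cong (count p) range ⟩
        count p (map suc (upTo (k * m)) ++ top)             ≡⟨ count-++ p (map suc (upTo (k * m))) top ⟩
        count p (map suc (upTo (k * m))) + count p top      ≡⟨ cong₂ _+_ (blockInversions-extend-old v 0 y) (count-none p top above) ⟩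
        blockInversions k d y + 0                           ≡⟨ +-identityʳ _ ⟩
        blockInversions k d y                               ∎
        where
        p = λ l → (blk e (inject₁ y) zero <ᵇ l) ∧ (minbIdx e l ≤ᵇ toℕ (inject₁ y))
        above : ∀ l → l ∈ top → p l ≡ false
        above l l∈ with ∈-map⁻ suc l∈
        ... | u , u∈ , refl with ∈-map⁻ (k * m +_) u∈
        ...   | t , _ , refl = trans (cong ((blk e (inject₁ y) zero <ᵇ suc (k * m + t)) ∧_) (≤ᵇ-false λ le → <⇒≱ (inject₁ℕ< y) (≤-trans n≤ le)))
                                 (∧-zeroʳ (blk e (inject₁ y) zero <ᵇ suc (k * m + t)))
          where
          n≤ : n ≤ minbIdx e (suc (k * m + t))
          n≤ = minbIdx-extend-empty d v 0 λ y′ c eq →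
            <⇒≱ (s≤s (m≤m+n (k * m) t)) (subst (_≤ k * m) eq (bounded y′ c))

module SemiringSums {c ℓ : Level} (R : CommutativeSemiring c ℓ) where
  open CommutativeSemiring R
    using (Carrier; 0#; 1#; _≈_; setoid; reflexive)
    renaming (_+_ to _⊕_; _*_ to _⊗_; refl to ≈-refl; sym to ≈-sym; trans to ≈-trans;
              +-cong to ⊕-cong; +-congˡ to ⊕-congˡ; +-congʳ to ⊕-congʳ; *-congˡ to ⊗-congˡ;
              +-assoc to ⊕-assoc; +-comm to ⊕-comm; +-identityˡ to ⊕-identityˡ; +-identityʳ to ⊕-identityʳ;
              *-identityˡ to ⊗-identityˡ; *-assoc to ⊗-assoc; zeroʳ to ⊗-zeroʳ; distribˡ to ⊗-distribˡ-⊕)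
  open CommutativeSemigroupProperties (CommutativeSemiring.+-commutativeSemigroup R) using ()
    renaming (interchange to ⊕-interchange)
  open CommutativeSemigroupProperties (CommutativeSemiring.*-commutativeSemigroup R) using ()
    renaming (x∙yz≈y∙xz to ⊗-x∙yz≈y∙xz)
  open Poly R
  open import Relation.Binary.Reasoning.Setoid setoid

  sumR-++ : ∀ xs ys → sumR (xs ++ ys) ≈ sumR xs ⊕ sumR ys
  sumR-++ []       ys = ≈-sym (⊕-identityˡ _)
  sumR-++ (x ∷ xs) ys = ≈-trans (⊕-congˡ (sumR-++ xs ys)) (≈-sym (⊕-assoc _ _ _))

  sumR-map-++ : ∀ {A : Set} (f : A → Carrier) xs ys → sumR (map f (xs ++ ys)) ≈ sumR (map f xs) ⊕ sumR (map f ys)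
  sumR-map-++ f xs ys = ≈-trans (reflexive (cong sumR (map-++ f xs ys))) (sumR-++ (map f xs) (map f ys))

  sumR-map-cong : ∀ {A : Set} (f g : A → Carrier) xs → (∀ x → x ∈ xs → f x ≈ g x) → sumR (map f xs) ≈ sumR (map g xs)
  sumR-map-cong f g []       _  = ≈-refl
  sumR-map-cong f g (x ∷ xs) eq = ⊕-cong (eq x (here refl)) (sumR-map-cong f g xs (λ y y∈ → eq y (there y∈)))

  sumR-map-∘ : ∀ {A B : Set} (f : B → Carrier) (g : A → B) xs → sumR (map f (map g xs)) ≈ sumR (map (f ∘ g) xs)
  sumR-map-∘ f g xs = reflexive (cong sumR (sym (map-∘ xs)))

  sumR-concatMap : ∀ {A B : Set} (f : B → Carrier) (g : A → List B) xs →
                   sumR (map f (concatMap g xs)) ≈ sumR (map (λ x → sumR (map f (g x))) xs)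
  sumR-concatMap f g []       = ≈-refl
  sumR-concatMap f g (x ∷ xs) = ≈-trans (sumR-map-++ f (g x) (concatMap g xs)) (⊕-congˡ (sumR-concatMap f g xs))

  sumR-*ˡ : ∀ {A : Set} a (f : A → Carrier) xs → sumR (map (λ x → a ⊗ f x) xs) ≈ a ⊗ sumR (map f xs)
  sumR-*ˡ a f []       = ≈-sym (⊗-zeroʳ a)
  sumR-*ˡ a f (x ∷ xs) = ≈-trans (⊕-congˡ (sumR-*ˡ a f xs)) (≈-sym (⊗-distribˡ-⊕ a _ _))

  pow-+ : ∀ q a b → pow q (a + b) ≈ pow q a ⊗ pow q b
  pow-+ q zero    b = ≈-sym (⊗-identityˡ _)
  pow-+ q (suc a) b = ≈-trans (⊗-congˡ (pow-+ q a b)) (≈-sym (⊗-assoc _ _ _))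

  qint-+ : ∀ q a b → qint q (a + b) ≈ qint q a ⊕ pow q a ⊗ qint q b
  qint-+ q a b = begin
    sumR (map (pow q) (upTo (a + b)))                            ≡⟨ cong (sumR ∘ map (pow q)) (upTo-+ a b) ⟩
    sumR (map (pow q) (upTo a ++ map (a +_) (upTo b)))           ≈⟨ sumR-map-++ (pow q) (upTo a) _ ⟩
    qint q a ⊕ sumR (map (pow q) (map (a +_) (upTo b)))         ≈⟨ ⊕-congˡ (sumR-map-∘ (pow q) (a +_) (upTo b)) ⟩
    qint q a ⊕ sumR (map (λ i → pow q (a + i)) (upTo b))         ≈⟨ ⊕-congˡ (sumR-map-cong _ _ (upTo b) (λ i _ → pow-+ q a i)) ⟩
    qint q a ⊕ sumR (map (λ i → pow q a ⊗ pow q i) (upTo b))     ≈⟨ ⊕-congˡ (sumR-*ˡ (pow q a) (pow q) (upTo b)) ⟩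
    qint q a ⊕ pow q a ⊗ qint q b                                ∎

  h-snoc : ∀ d xs y → h (suc d) (xs ++ [ y ]) ≈ h (suc d) xs ⊕ y ⊗ h d (xs ++ [ y ])
  h-snoc d       []       y = ≈-refl
  h-snoc zero    (x ∷ xs) y = begin
    h 1 (xs ++ [ y ]) ⊕ x ⊗ 1#          ≈⟨ ⊕-congʳ (h-snoc zero xs y) ⟩
    (h 1 xs ⊕ y ⊗ 1#) ⊕ x ⊗ 1#          ≈⟨ ⊕-assoc _ _ _ ⟩
    h 1 xs ⊕ (y ⊗ 1# ⊕ x ⊗ 1#)          ≈⟨ ⊕-congˡ (⊕-comm _ _) ⟩
    h 1 xs ⊕ (x ⊗ 1# ⊕ y ⊗ 1#)          ≈⟨ ⊕-assoc _ _ _ ⟨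
    (h 1 xs ⊕ x ⊗ 1#) ⊕ y ⊗ 1#          ∎
  h-snoc (suc d) (x ∷ xs) y = begin
    h (suc (suc d)) (xs ++ [ y ]) ⊕ x ⊗ h (suc d) (x ∷ xs ++ [ y ])
                                        ≈⟨ ⊕-cong (h-snoc (suc d) xs y) (⊗-congˡ (h-snoc d (x ∷ xs) y)) ⟩
    (A ⊕ y ⊗ B) ⊕ x ⊗ (C ⊕ y ⊗ D)       ≈⟨ ⊕-congˡ (⊗-distribˡ-⊕ x C (y ⊗ D)) ⟩
    (A ⊕ y ⊗ B) ⊕ (x ⊗ C ⊕ x ⊗ (y ⊗ D)) ≈⟨ ⊕-interchange A (y ⊗ B) (x ⊗ C) (x ⊗ (y ⊗ D)) ⟩
    (A ⊕ x ⊗ C) ⊕ (y ⊗ B ⊕ x ⊗ (y ⊗ D)) ≈⟨ ⊕-congˡ (⊕-congˡ (⊗-x∙yz≈y∙xz x y D)) ⟩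
    (A ⊕ x ⊗ C) ⊕ (y ⊗ B ⊕ y ⊗ (x ⊗ D)) ≈⟨ ⊕-congˡ (⊗-distribˡ-⊕ y B (x ⊗ D)) ⟨
    (A ⊕ x ⊗ C) ⊕ y ⊗ (B ⊕ x ⊗ D)       ∎
    where
    A = h (suc (suc d)) xs
    B = h (suc d) (xs ++ [ y ])
    C = h (suc d) (x ∷ xs)
    D = h d (x ∷ xs ++ [ y ])

  below : (ℕ → Carrier) → ℕ → Carrier
  below f zero    = 0#
  below f (suc k) = f k

  module _ (q : Carrier) (m : ℕ) where

    x : ℕ → Carrier
    x j = qint q (suc j * m ∸ 1)

    Stilde-≤ : ∀ {n k} → k ≤ n → Stilde q m n k ≡ h (n ∸ k) (map x (upTo (suc k)))
    Stilde-≤ {n} {k} k≤n = cong (λ b → if b then h (n ∸ k) (map x (upTo (suc k))) else 0#) (≤ᵇ-true k≤n)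

    Stilde-> : ∀ {n k} → n < k → Stilde q m n k ≡ 0#
    Stilde-> {n} {k} n<k = cong (λ b → if b then h (n ∸ k) (map x (upTo (suc k))) else 0#) (≤ᵇ-false (<⇒≱ n<k))

    Stilde-suc : ∀ n k → Stilde q m (suc n) k ≈ below (Stilde q m n) k ⊕ x k ⊗ Stilde q m n k
    Stilde-suc n zero    = ≈-refl
    Stilde-suc n (suc k) with <-cmp k n
    ... | tri< k<n _ _ = begin
      Stilde q m (suc n) (suc k)                                 ≡⟨ Stilde-≤ (s≤s (<⇒≤ k<n)) ⟩
      h (n ∸ k) (map x (upTo (suc (suc k))))                     ≡⟨ cong₂ h (∸-suc k<n) xs-snoc ⟩
      h (suc (n ∸ suc k)) (xs ++ [ x (suc k) ])                  ≈⟨ h-snoc (n ∸ suc k) xs (x (suc k)) ⟩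
      h (suc (n ∸ suc k)) xs ⊕ x (suc k) ⊗ h (n ∸ suc k) (xs ++ [ x (suc k) ])
        ≡⟨ cong₂ (λ a b → a ⊕ x (suc k) ⊗ b) (trans (cong (λ d → h d xs) (sym (∸-suc k<n))) (sym (Stilde-≤ (<⇒≤ k<n))))
                                             (trans (cong (h (n ∸ suc k)) (sym xs-snoc)) (sym (Stilde-≤ k<n))) ⟩
      Stilde q m n k ⊕ x (suc k) ⊗ Stilde q m n (suc k)          ∎
      where
      xs = map x (upTo (suc k))
      ∸-suc : ∀ {k n} → k < n → n ∸ k ≡ suc (n ∸ suc k)
      ∸-suc {n = suc n} (s≤s k≤n) = +-∸-assoc 1 k≤n
      xs-snoc : map x (upTo (suc (suc k))) ≡ xs ++ [ x (suc k) ]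
      xs-snoc = trans (cong (map x) (sym (upTo-∷ʳ (suc k)))) (map-++ x (upTo (suc k)) [ suc k ])
    ... | tri≈ _ refl _ = begin
      Stilde q m (suc k) (suc k)                     ≡⟨ Stilde-≤ {suc k} {suc k} ≤-refl ⟩
      h (k ∸ k) (map x (upTo (suc (suc k))))         ≡⟨ cong (λ d → h d (map x (upTo (suc (suc k))))) (n∸n≡0 k) ⟩
      1#                                             ≈⟨ ⊕-identityʳ 1# ⟨
      1# ⊕ 0#                                        ≈⟨ ⊕-congˡ (⊗-zeroʳ (x (suc k))) ⟨
      1# ⊕ x (suc k) ⊗ 0#                            ≡⟨ cong₂ (λ a b → a ⊕ x (suc k) ⊗ b)
                                                           (trans (cong (λ d → h d (map x (upTo (suc k)))) (sym (n∸n≡0 k))) (sym (Stilde-≤ {k} {k} ≤-refl)))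
                                                           (sym (Stilde-> {k} (n<1+n k))) ⟩
      Stilde q m k k ⊕ x (suc k) ⊗ Stilde q m k (suc k) ∎
    ... | tri> _ _ n<k = begin
      Stilde q m (suc n) (suc k)                     ≡⟨ Stilde-> (s≤s n<k) ⟩
      0#                                             ≈⟨ ⊕-identityʳ 0# ⟨
      0# ⊕ 0#                                        ≈⟨ ⊕-congˡ (⊗-zeroʳ (x (suc k))) ⟨
      0# ⊕ x (suc k) ⊗ 0#                            ≡⟨ cong₂ (λ a b → a ⊕ x (suc k) ⊗ b) (sym (Stilde-> n<k)) (sym (Stilde-> {n} (m<n⇒m<1+n n<k))) ⟩
      Stilde q m n k ⊕ x (suc k) ⊗ Stilde q m n (suc k) ∎

module Main {c ℓ : Level} (R : CommutativeSemiring c ℓ) (q : CommutativeSemiring.Carrier R) (m-1 : ℕ) where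
  open CommutativeSemiring R
    using (Carrier; 1#; _≈_; setoid; reflexive)
    renaming (_+_ to _⊕_; _*_ to _⊗_; refl to ≈-refl; sym to ≈-sym; trans to ≈-trans;
              +-cong to ⊕-cong; +-congˡ to ⊕-congˡ; *-congˡ to ⊗-congˡ; +-comm to ⊕-comm; +-identityʳ to ⊕-identityʳ;
              *-comm to ⊗-comm; distribˡ to ⊗-distribˡ-⊕)
  open Poly R
  open SemiringSums R
  open Labels m-1 using (m)
  open Partitions m-1 using (IsSSP)
  open Enumeration m-1
  open Inversions m-1 using (inv; inv-joinS₀; inv-joinBlock; inv-openGroup)
  open import Relation.Binary.Reasoning.Setoid setoid

  weight : ∀ {n} → ℕ → SPData m n → Carrier
  weight k d = pow q (inv k d)

  weightSum : ℕ → ℕ → Carrier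
  weightSum n k = sumR (map (weight k) (ssps n k))

  extensions-weight : ∀ {n k} (d : SPData m n) → IsSSP n k d → sumR (map (weight k) (extensions k d)) ≈ x q m k ⊗ weight k d
  extensions-weight {k = k} d ssp = begin
    sumR (map (weight k) (map (joinS₀ d) (upTo m-1) ++ map (joinBlock k d) (upTo (k * m))))
      ≈⟨ sumR-map-++ (weight k) (map (joinS₀ d) (upTo m-1)) _ ⟩
    sumR (map (weight k) (map (joinS₀ d) (upTo m-1))) ⊕ sumR (map (weight k) (map (joinBlock k d) (upTo (k * m))))
      ≈⟨ ⊕-cong (sumR-map-∘ (weight k) (joinS₀ d) (upTo m-1)) (sumR-map-∘ (weight k) (joinBlock k d) (upTo (k * m))) ⟩
    sumR (map (weight k ∘ joinS₀ d) (upTo m-1)) ⊕ sumR (map (weight k ∘ joinBlock k d) (upTo (k * m)))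
      ≈⟨ ⊕-cong (sumR-map-cong _ _ (upTo m-1) λ i i∈ → S₀-weight (∈-upTo⁻ i∈))
                (sumR-map-cong _ _ (upTo (k * m)) λ i i∈ → block-weight (∈-upTo⁻ i∈)) ⟩
    sumR (map (λ i → w ⊗ (pow q (k * m) ⊗ pow q i)) (upTo m-1)) ⊕ sumR (map (λ i → w ⊗ pow q i) (upTo (k * m)))
      ≈⟨ ⊕-cong (≈-trans (sumR-*ˡ w _ (upTo m-1)) (⊗-congˡ (sumR-*ˡ (pow q (k * m)) (pow q) (upTo m-1))))
                (sumR-*ˡ w (pow q) (upTo (k * m))) ⟩
    w ⊗ (pow q (k * m) ⊗ qint q m-1) ⊕ w ⊗ qint q (k * m)
      ≈⟨ ⊗-distribˡ-⊕ w _ _ ⟨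
    w ⊗ (pow q (k * m) ⊗ qint q m-1 ⊕ qint q (k * m))
      ≈⟨ ⊗-congˡ (≈-trans (⊕-comm _ _) (≈-sym (qint-+ q (k * m) m-1))) ⟩
    w ⊗ qint q (k * m + m-1)
      ≡⟨ cong (λ j → w ⊗ qint q j) (+-comm (k * m) m-1) ⟩
    w ⊗ x q m k
      ≈⟨ ⊗-comm w (x q m k) ⟩
    x q m k ⊗ w
      ∎
    where
    w = weight k d
    S₀-weight : ∀ {i} → i < m-1 → weight k (joinS₀ d i) ≈ w ⊗ (pow q (k * m) ⊗ pow q i)
    S₀-weight {i} i<m-1 = ≈-trans (reflexive (cong (pow q) (inv-joinS₀ {k = k} {d = d} ssp i<m-1)))
                                  (≈-trans (pow-+ q (inv k d) _) (⊗-congˡ (pow-+ q (k * m) i)))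
    block-weight : ∀ {i} → i < k * m → weight k (joinBlock k d i) ≈ w ⊗ pow q i
    block-weight i<km = ≈-trans (reflexive (cong (pow q) (inv-joinBlock {k = k} {d = d} ssp i<km))) (pow-+ q (inv k d) _)

  openings-weight : ∀ n k → sumR (map (weight k) (openings n k)) ≈ below (weightSum n) k
  openings-weight n zero    = ≈-refl
  openings-weight n (suc k) = ≈-trans (sumR-map-∘ (weight (suc k)) (openGroup k) (ssps n k))
    (sumR-map-cong _ _ (ssps n k) λ d d∈ → reflexive (cong (pow q) (inv-openGroup {k = k} {d = d} (ssps-sound n k d∈))))

  weightSum-suc : ∀ n k → weightSum (suc n) k ≈ below (weightSum n) k ⊕ x q m k ⊗ weightSum n k
  weightSum-suc n k = begin
    sumR (map (weight k) (openings n k ++ concatMap (extensions k) (ssps n k)))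
      ≈⟨ sumR-map-++ (weight k) (openings n k) _ ⟩
    sumR (map (weight k) (openings n k)) ⊕ sumR (map (weight k) (concatMap (extensions k) (ssps n k)))
      ≈⟨ ⊕-cong (openings-weight n k) (sumR-concatMap (weight k) (extensions k) (ssps n k)) ⟩
    below (weightSum n) k ⊕ sumR (map (λ d → sumR (map (weight k) (extensions k d))) (ssps n k))
      ≈⟨ ⊕-congˡ (sumR-map-cong _ _ (ssps n k) λ d d∈ → extensions-weight {k = k} d (ssps-sound n k d∈)) ⟩
    below (weightSum n) k ⊕ sumR (map (λ d → x q m k ⊗ weight k d) (ssps n k))
      ≈⟨ ⊕-congˡ (sumR-*ˡ (x q m k) (weight k) (ssps n k)) ⟩
    below (weightSum n) k ⊕ x q m k ⊗ weightSum n k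
      ∎

  weightSum≈Stilde : ∀ n k → weightSum n k ≈ Stilde q m n k
  weightSum≈Stilde zero    zero    = ⊕-identityʳ 1#
  weightSum≈Stilde zero    (suc k) = ≈-refl
  weightSum≈Stilde (suc n) k       = begin
    weightSum (suc n) k                                   ≈⟨ weightSum-suc n k ⟩
    below (weightSum n) k ⊕ x q m k ⊗ weightSum n k       ≈⟨ ⊕-cong (below-≈ k) (⊗-congˡ (weightSum≈Stilde n k)) ⟩
    below (Stilde q m n) k ⊕ x q m k ⊗ Stilde q m n k     ≈⟨ Stilde-suc q m n k ⟨
    Stilde q m (suc n) k                                  ∎
    where
    below-≈ : ∀ k → below (weightSum n) k ≈ below (Stilde q m n) k
    below-≈ zero    = ≈-refl
    below-≈ (suc k) = weightSum≈Stilde n k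

theorem4p3 : ∀ {c ℓ} (R : CommutativeSemiring c ℓ) (q : CommutativeSemiring.Carrier R)
               (m-1 n k : ℕ) →
               Σ (List (SPData (suc m-1) n)) λ L →
                 (∀ d → (d ∈ L) ⇔ SSP.IsSSP m-1 n k d)
                 × Unique L
                 × CommutativeSemiring._≈_ R
                     (Poly.sumR R (map (λ d → Poly.pow R q (SSP.inv m-1 n k d)) L))
                     (Poly.Stilde R q (suc m-1) n k)
theorem4p3 R q m-1 n k =
    ssps n k
  , (λ d → mk⇔ (ssps-sound n k) (ssps-complete n k d))
  , ssps-unique n k
  , weightSum≈Stilde n k
  where
  open Enumeration m-1
  open Main R q m-1
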